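{- If $M\in\Lambda_{\circledR}^{[/]}$, then its $\to^{[/]}$-normal form $M\!\downarrow^{[/]}$ belongs to $\Lambda_{\circledR}$ (i.e. contains no substitution operator).
   Context: Fix a countably infinite set of variables. The set $\Lambda_{\circledR}$ of terms and $Fv(M)$ are defined simultaneously: every variable $x$ is a term with $Fv(x)=\{x\}$; $\lambda x.M$ is a term if $M$ is a term and $x\in Fv(M)$ ($Fv=Fv(M)\setminus\{x\}$); $MN$ is a term if $M,N$ are terms with $Fv(M)\cap Fv(N)=\emptyset$ ($Fv=Fv(M)\cup Fv(N)$); $x\odot M$ (erasure) is a term if $M$ is a term and $x\notin Fv(M)$ ($Fv=\{x\}\cup Fv(M)$); $x<^{x_1}_{x_2}M$ (duplication) is a term if $M$ is a term, $x_1,x_2\in Fv(M)$, $x_1\neq x_2$, $x\notin Fv(M)\setminus\{x_1,x_2\}$ ($Fv=\{x\}\cup(Fv(M)\setminus\{x_1,x_2\})$). $\lambda x$ binds $x$, duplication binds $x_1,x_2$; $\alpha$-conversion and Barendregt's convention are assumed. $Fv[M]$ is the ordered list of free variables. For lists $X,Y,Z$ of equal length, $X\odot M$ and $X<^{Y}_{Z}M$ denote iterated erasures/duplications ($=M$ for empty lists). The set $\Lambda_{\circledR}^{[/]}$ and $Fv^{[/]}$ are defined by the same clauses (with $Fv^{[/]}$ in place of $Fv$) plus: $M[N/x]\in\Lambda_{\circledR}^{[/]}$ if $M\in\Lambda_{\circledR}^{[/]}$, $x\in Fv^{[/]}(M)$, $N\in\Lambda_{\circledR}$ and $(Fv^{[/]}(M)\setminus\{x\})\cap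 Fv(N)=\emptyset$, with $Fv^{[/]}(M[N/x])=(Fv^{[/]}(M)\setminus\{x\})\cup Fv(N)$ ($x$ is bound in $M$). The one-step relation $\to^{[/]}$ is closed under $\alpha$-equivalence and contexts and given by: $x[N/x]\to N$; $(\lambda y.M)[N/x]\to\lambda y.M[N/x]$ ($x\ne y$); $(MP)[N/x]\to M[N/x]P$ if $x\in Fv^{[/]}(M)$; $(MP)[N/x]\to M\,P[N/x]$ if $x\in Fv^{[/]}(P)$; $(y\odot M)[N/x]\to y\odot M[N/x]$ ($x\neq y$); $(x\odot M)[N/x]\to Fv(N)\odot M$; $(y<^{y_1}_{y_2}M)[N/x]\to y<^{y_1}_{y_2}M[N/x]$ ($x\ne y$); $(x<^{x_1}_{x_2}M)[N/x]\to Fv[N]<^{Fv[N_1]}_{Fv[N_2]}M[N_1/x_1][N_2/x_2]$, with $N_1,N_2$ obtained from $N$ by renaming all free variables to fresh ones. The relation $\to^{[/]}$ terminates and is confluent, so each $M\in\Lambda_{\circledR}^{[/]}$ has a unique $\to^{[/]}$-normal form $M\!\downarrow^{[/]}$ (a term to which no rule applies). -}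

module Defs where

open import Data.Nat using (ℕ; _≟_)
open import Data.List using (List; []; _∷_; _++_; zip; length)
open import Data.List.Membership.Propositional using (_∈_; _∉_)
open import Data.List.Relation.Binary.Disjoint.Propositional using (Disjoint)
open import Data.List.Relation.Unary.Unique.Propositional using (Unique)
open import Data.Product using (_×_; _,_; ∃; Σ)
open import Data.Sum using (_⊎_)
open import Relation.Nullary using (¬_; yes; no)
open import Relation.Binary.PropositionalEquality using (_≡_; _≢_)
open import Relation.Binary.Construct.Closure.ReflexiveTransitive using (Star)

Var : Set
Var = ℕ

-- Raw (named) syntax of Λ_® extended with explicit substitution.
data Term : Set where
  var : Var → Term
  lam : Var → Term → Term
  app : Term → Term → Term
  era : Var → Term → Term                -- x ⊙ M
  dup : Var → Var → Var → Term → Term    -- x <^{x1}_{x2} M   (dup x x1 x2 M)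
  sub : Term → Var → Term → Term         -- M[N/x]            (sub M x N)

_∖_ : List Var → Var → List Var
[] ∖ x = []
(y ∷ ys) ∖ x with y ≟ x
... | yes _ = ys ∖ x
... | no  _ = y ∷ (ys ∖ x)

-- Ordered list of free variables Fv[M] (left-to-right order of occurrence);
-- on Λ_® it is Fv, on Λ^{[/]} it is Fv^{[/]}.
fv : Term → List Var
fv (var x) = x ∷ []
fv (lam x M) = fv M ∖ x
fv (app M N) = fv M ++ fv N
fv (era x M) = x ∷ fv M
fv (dup x x₁ x₂ M) = x ∷ ((fv M ∖ x₁) ∖ x₂)
fv (sub M x N) = (fv M ∖ x) ++ fv N

vars : Term → List Var
vars (var x) = x ∷ []
vars (lam x M) = x ∷ vars M
vars (app M N) = vars M ++ vars N
vars (era x M) = x ∷ vars M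
vars (dup x x₁ x₂ M) = x ∷ x₁ ∷ x₂ ∷ vars M
vars (sub M x N) = x ∷ vars M ++ vars N

-- Well-formed terms of Λ_® (no substitution operator).
data WF : Term → Set where
  wf-var : ∀ x → WF (var x)
  wf-lam : ∀ x M → WF M → x ∈ fv M → WF (lam x M)
  wf-app : ∀ M N → WF M → WF N → Disjoint (fv M) (fv N) → WF (app M N)
  wf-era : ∀ x M → WF M → x ∉ fv M → WF (era x M)
  wf-dup : ∀ x x₁ x₂ M → WF M → x₁ ∈ fv M → x₂ ∈ fv M → x₁ ≢ x₂
         → x ∉ ((fv M ∖ x₁) ∖ x₂) → WF (dup x x₁ x₂ M)

-- Well-formed terms of Λ_®^{[/]}.
data WFs : Term → Set where
  wfs-var : ∀ x → WFs (var x)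
  wfs-lam : ∀ x M → WFs M → x ∈ fv M → WFs (lam x M)
  wfs-app : ∀ M N → WFs M → WFs N → Disjoint (fv M) (fv N) → WFs (app M N)
  wfs-era : ∀ x M → WFs M → x ∉ fv M → WFs (era x M)
  wfs-dup : ∀ x x₁ x₂ M → WFs M → x₁ ∈ fv M → x₂ ∈ fv M → x₁ ≢ x₂
          → x ∉ ((fv M ∖ x₁) ∖ x₂) → WFs (dup x x₁ x₂ M)
  wfs-sub : ∀ M x N → WFs M → x ∈ fv M → WF N
          → Disjoint (fv M ∖ x) (fv N) → WFs (sub M x N)

-- Renaming of free variables along a finite map (list of pairs; first match wins).
lookupRen : List (Var × Var) → Var → Var
lookupRen [] x = x
lookupRen ((a , b) ∷ ρ) x with a ≟ x
... | yes _ = b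
... | no  _ = lookupRen ρ x

dropRen : List (Var × Var) → Var → List (Var × Var)
dropRen [] x = []
dropRen ((a , b) ∷ ρ) x with a ≟ x
... | yes _ = dropRen ρ x
... | no  _ = (a , b) ∷ dropRen ρ x

ren : List (Var × Var) → Term → Term
ren ρ (var x) = var (lookupRen ρ x)
ren ρ (lam x M) = lam x (ren (dropRen ρ x) M)
ren ρ (app M N) = app (ren ρ M) (ren ρ N)
ren ρ (era x M) = era (lookupRen ρ x) (ren ρ M)
ren ρ (dup x x₁ x₂ M) = dup (lookupRen ρ x) x₁ x₂ (ren (dropRen (dropRen ρ x₁) x₂) M)
ren ρ (sub M x N) = sub (ren (dropRen ρ x) M) x (ren ρ N)

-- Iterated erasure X ⊙ M and iterated duplication X <^Y_Z M (= M on empty lists).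
eras : List Var → Term → Term
eras [] M = M
eras (x ∷ xs) M = era x (eras xs M)

dups : List Var → List Var → List Var → Term → Term
dups (x ∷ xs) (y ∷ ys) (z ∷ zs) M = dup x y z (dups xs ys zs M)
dups _ _ _ M = M

data _α₁_ : Term → Term → Set where
  α-lam  : ∀ x x' M → x' ∉ vars M → lam x M α₁ lam x' (ren ((x , x') ∷ []) M)
  α-dup₁ : ∀ x x₁ x₁' x₂ M → x₁' ∉ vars M → x₁' ≢ x → x₁' ≢ x₂
         → dup x x₁ x₂ M α₁ dup x x₁' x₂ (ren ((x₁ , x₁') ∷ []) M)
  α-dup₂ : ∀ x x₁ x₂ x₂' M → x₂' ∉ vars M → x₂' ≢ x → x₂' ≢ x₁
         → dup x x₁ x₂ M α₁ dup x x₁ x₂' (ren ((x₂ , x₂') ∷ []) M)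
  α-sub  : ∀ M x x' N → x' ∉ vars M → x' ∉ vars N
         → sub M x N α₁ sub (ren ((x , x') ∷ []) M) x' N

data _≡α_ : Term → Term → Set where
  α-step  : ∀ {M N} → M α₁ N → M ≡α N
  α-refl  : ∀ {M} → M ≡α M
  α-sym   : ∀ {M N} → M ≡α N → N ≡α M
  α-trans : ∀ {M N P} → M ≡α N → N ≡α P → M ≡α P
  α-cλ    : ∀ {x M M'} → M ≡α M' → lam x M ≡α lam x M'
  α-cappl : ∀ {M M' N} → M ≡α M' → app M N ≡α app M' N
  α-cappr : ∀ {M N N'} → N ≡α N' → app M N ≡α app M N'
  α-cera  : ∀ {x M M'} → M ≡α M' → era x M ≡α era x M'
  α-cdup  : ∀ {x x₁ x₂ M M'} → M ≡α M' → dup x x₁ x₂ M ≡α dup x x₁ x₂ M'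
  α-csubl : ∀ {M M' x N} → M ≡α M' → sub M x N ≡α sub M' x N
  α-csubr : ∀ {M x N N'} → N ≡α N' → sub M x N ≡α sub M x N'

-- The root rules of →^{[/]} (side conditions reflect Barendregt's convention).
data _⟶r_ : Term → Term → Set where
  r-var  : ∀ x N → sub (var x) x N ⟶r N
  r-lam  : ∀ y M x N → x ≢ y → y ∉ fv N
         → sub (lam y M) x N ⟶r lam y (sub M x N)
  r-appl : ∀ M P x N → x ∈ fv M
         → sub (app M P) x N ⟶r app (sub M x N) P
  r-appr : ∀ M P x N → x ∈ fv P
         → sub (app M P) x N ⟶r app M (sub P x N)
  r-era  : ∀ y M x N → x ≢ y
         → sub (era y M) x N ⟶r era y (sub M x N)
  r-eraₓ : ∀ M x N
         → sub (era x M) x N ⟶r eras (fv N) M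
  r-dup  : ∀ y y₁ y₂ M x N → x ≢ y → x ≢ y₁ → x ≢ y₂ → y₁ ∉ fv N → y₂ ∉ fv N
         → sub (dup y y₁ y₂ M) x N ⟶r dup y y₁ y₂ (sub M x N)
  -- N₁, N₂: N with all free variables renamed to fresh ones (ys, zs).
  r-dupₓ : ∀ x₁ x₂ M x N (ys zs : List Var)
         → length ys ≡ length (fv N) → length zs ≡ length (fv N)
         → Unique (ys ++ zs)
         → (∀ v → v ∈ ys ++ zs → v ∉ vars (sub (dup x x₁ x₂ M) x N))
         → sub (dup x x₁ x₂ M) x N ⟶r
           dups (fv N) ys zs
             (sub (sub M x₁ (ren (zip (fv N) ys) N)) x₂ (ren (zip (fv N) zs) N))

data _⟶c_ : Term → Term → Set where
  c-root : ∀ {M N} → M ⟶r N → M ⟶c N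
  c-lam  : ∀ {x M M'} → M ⟶c M' → lam x M ⟶c lam x M'
  c-appl : ∀ {M M' N} → M ⟶c M' → app M N ⟶c app M' N
  c-appr : ∀ {M N N'} → N ⟶c N' → app M N ⟶c app M N'
  c-era  : ∀ {x M M'} → M ⟶c M' → era x M ⟶c era x M'
  c-dup  : ∀ {x x₁ x₂ M M'} → M ⟶c M' → dup x x₁ x₂ M ⟶c dup x x₁ x₂ M'
  c-subl : ∀ {M M' x N} → M ⟶c M' → sub M x N ⟶c sub M' x N
  c-subr : ∀ {M x N N'} → N ⟶c N' → sub M x N ⟶c sub M x N'

_⟶_ : Term → Term → Set
M ⟶ N = ∃ λ M' → ∃ λ N' → (M ≡α M') × (M' ⟶c N') × (N' ≡α N)

_⟶*_ : Term → Term → Set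
_⟶*_ = Star _⟶_

Normal : Term → Set
Normal M = ∀ N → ¬ (M ⟶ N)

module Submission where

-- Let NoSub M say that M contains no substitution operator; Λ_® consists
-- exactly of the well-formed terms of Λ_®^{[/]} satisfying NoSub.  The
-- argument has the two halves of a type-safety proof.
--
--  * Preservation.  A step M ⟶ N is an α-conversion, a contextual step and
--    another α-conversion.  α-equivalent terms agree on WFs, NoSub and the
--    set of free variables (a consequence of the theory of capture-avoiding
--    renamings developed first), and every root rule preserves WFs and the
--    free-variable set; this lifts through contexts, as the side conditions
--    of WFs only mention free-variable sets.  A well-formed term is either substitution-free or steps: an
--    innermost substitution M[N/x] has x ∈ Fv(M) and M substitution-free,
--    so a root rule applies once bound names are renamed apart.
--
-- Hence a normal term reachable from a well-formed one is well-formed and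
-- substitution-free, i.e. it belongs to Λ_®.

open import Defs
open import Data.Nat using (ℕ; suc; _≟_; _+_; _≤_; _<_)
open import Data.Nat.Properties
  using (suc-injective; ≤-refl; ≤-trans; m≤m+n; <⇒≢; <-≤-trans; ≤-<-trans; +-monoʳ-<)
open import Data.List using (List; []; _∷_; _++_; zip; length; applyUpTo)
open import Data.List.Properties using (length-applyUpTo)
open import Data.List.Extrema.Nat using (max; xs≤max)
open import Data.List.Membership.Propositional using (_∈_; _∉_)
open import Data.List.Membership.Propositional.Properties
  using (∈-++⁺ˡ; ∈-++⁺ʳ; ∈-++⁻; ∈-applyUpTo⁻)
open import Data.List.Relation.Unary.Any using (here; there)
open import Data.List.Relation.Unary.All as All using ()
open import Data.List.Relation.Unary.All.Properties using (¬Any⇒All¬)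
open import Data.List.Relation.Unary.AllPairs using ([]; _∷_)
open import Data.List.Relation.Binary.Subset.Propositional using (_⊆_)
open import Data.List.Relation.Binary.Subset.Propositional.Properties
  using (⊆-refl; ⊆-trans; ∷⁺ʳ) renaming (++⁺ to ++-⊆)
open import Data.List.Relation.Binary.Disjoint.Propositional using (Disjoint)
open import Data.List.Relation.Unary.Unique.Propositional using (Unique)
open import Data.List.Relation.Unary.Unique.Propositional.Properties
  using (Unique[x∷xs]⇒x∉xs; applyUpTo⁺₁) renaming (++⁺ to unique-++)
open import Data.Product using (_×_; _,_; Σ; proj₁; proj₂)
open import Data.Sum using (_⊎_; inj₁; inj₂)
open import Data.Empty using (⊥; ⊥-elim)
open import Data.Unit using (⊤; tt)
open import Relation.Nullary using (¬_; yes; no)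
open import Relation.Binary.PropositionalEquality
  using (_≡_; _≢_; refl; sym; trans; cong; cong₂; subst)
open import Relation.Binary.Construct.Closure.ReflexiveTransitive using (ε; _◅_)

-- Variable lists read as finite sets

infix 4 _≃_
_≃_ : List Var → List Var → Set
xs ≃ ys = xs ⊆ ys × ys ⊆ xs

≃-refl : ∀ {xs} → xs ≃ xs
≃-refl = ⊆-refl , ⊆-refl

≃-sym : ∀ {xs ys} → xs ≃ ys → ys ≃ xs
≃-sym (xs⊆ys , ys⊆xs) = ys⊆xs , xs⊆ys

≃-trans : ∀ {xs ys zs} → xs ≃ ys → ys ≃ zs → xs ≃ zs
≃-trans (a , b) (c , d) = ⊆-trans a c , ⊆-trans d b

∈-∖⁻ : ∀ {v} xs x → v ∈ xs ∖ x → v ∈ xs × v ≢ x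
∈-∖⁻ (y ∷ ys) x p with y ≟ x
... | yes _ = let q , v≢x = ∈-∖⁻ ys x p in there q , v≢x
∈-∖⁻ (y ∷ ys) x (here refl) | no y≢x = here refl , y≢x
∈-∖⁻ (y ∷ ys) x (there p)   | no _   = let q , v≢x = ∈-∖⁻ ys x p in there q , v≢x

∈-∖⁺ : ∀ {v} xs x → v ∈ xs → v ≢ x → v ∈ xs ∖ x
∈-∖⁺ (y ∷ ys) x p v≢x with y ≟ x | p
... | yes refl | here refl = ⊥-elim (v≢x refl)
... | yes _    | there q   = ∈-∖⁺ ys x q v≢x
... | no _     | here refl = here refl
... | no _     | there q   = there (∈-∖⁺ ys x q v≢x)

∖-mono : ∀ {xs ys} x → xs ⊆ ys → xs ∖ x ⊆ ys ∖ x
∖-mono {xs} {ys} x xs⊆ys p = let q , v≢x = ∈-∖⁻ xs x p in ∈-∖⁺ ys x (xs⊆ys q) v≢x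

∖-cong : ∀ {xs ys} x → xs ≃ ys → xs ∖ x ≃ ys ∖ x
∖-cong x (a , b) = ∖-mono x a , ∖-mono x b

∈-tail : ∀ {a w : Var} {X} → w ∈ a ∷ X → a ≢ w → w ∈ X
∈-tail (here refl) a≢w = ⊥-elim (a≢w refl)
∈-tail (there p) _ = p

∈-∖∖⁻ : ∀ {v} xs a b → v ∈ (xs ∖ a) ∖ b → v ∈ xs × v ≢ a × v ≢ b
∈-∖∖⁻ xs a b p =
  let q , v≢b = ∈-∖⁻ (xs ∖ a) b p ; r , v≢a = ∈-∖⁻ xs a q in r , v≢a , v≢b

∈-∖∖⁺ : ∀ {v} xs a b → v ∈ xs → v ≢ a → v ≢ b → v ∈ (xs ∖ a) ∖ b
∈-∖∖⁺ xs a b p v≢a v≢b = ∈-∖⁺ (xs ∖ a) b (∈-∖⁺ xs a p v≢a) v≢b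

++-cong : ∀ {xs ys xs' ys'} → xs ≃ xs' → ys ≃ ys' → xs ++ ys ≃ xs' ++ ys'
++-cong (a , b) (c , d) = ++-⊆ a c , ++-⊆ b d

∷-cong : ∀ {x xs ys} → xs ≃ ys → x ∷ xs ≃ x ∷ ys
∷-cong {x} (a , b) = ∷⁺ʳ x a , ∷⁺ʳ x b

disjoint-mono : ∀ {xs ys xs' ys' : List Var}
              → xs' ⊆ xs → ys' ⊆ ys → Disjoint xs ys → Disjoint xs' ys'
disjoint-mono a b d (p , q) = d (a p , b q)

unique-∷ : ∀ {x : Var} {xs} → x ∉ xs → Unique xs → Unique (x ∷ xs)
unique-∷ {xs = xs} x∉xs u = ¬Any⇒All¬ xs x∉xs ∷ u

unique-∖ : ∀ (xs : List Var) x → Unique xs → Unique (xs ∖ x)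
unique-∖ [] x u = []
unique-∖ (y ∷ ys) x (y∉ys ∷ u) with y ≟ x
... | yes _ = unique-∖ ys x u
... | no _  =
  unique-∷ (λ p → Unique[x∷xs]⇒x∉xs (y∉ys ∷ u) (proj₁ (∈-∖⁻ ys x p))) (unique-∖ ys x u)

unique-++⁻ : ∀ (xs ys : List Var) → Unique (xs ++ ys) → Unique xs × Unique ys × Disjoint xs ys
unique-++⁻ [] ys u = [] , u , λ { (() , _) }
unique-++⁻ (x ∷ xs) ys u@(_ ∷ u') with unique-++⁻ xs ys u'
... | uxs , uys , disj =
  unique-∷ (λ p → x∉ (∈-++⁺ˡ p)) uxs , uys ,
  λ { (here refl , q) → x∉ (∈-++⁺ʳ xs q) ; (there p , q) → disj (p , q) }
  where
  x∉ : x ∉ xs ++ ys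
  x∉ = Unique[x∷xs]⇒x∉xs u

-- Renamings as functions on variables

≡-or-≢ : (v y : Var) → (v ≡ y) ⊎ (v ≢ y)
≡-or-≢ v y with v ≟ y
... | yes v≡y = inj₁ v≡y
... | no v≢y  = inj₂ v≢y

≢-sym : ∀ {a b : Var} → a ≢ b → b ≢ a
≢-sym a≢b b≡a = a≢b (sym b≡a)

-- The renaming f acting below a binder of y: y itself is left alone.
shadow : (Var → Var) → Var → Var → Var
shadow f y v with v ≟ y
... | yes _ = v
... | no _  = f v

shadow-self : ∀ f y → shadow f y y ≡ y
shadow-self f y with y ≟ y
... | yes _   = refl
... | no y≢y = ⊥-elim (y≢y refl)

shadow-other : ∀ f y v → v ≢ y → shadow f y v ≡ f v
shadow-other f y v v≢y with v ≟ y
... | yes v≡y = ⊥-elim (v≢y v≡y)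
... | no _    = refl

shadow₂-other : ∀ f a b v → v ≢ a → v ≢ b → shadow (shadow f a) b v ≡ f v
shadow₂-other f a b v v≢a v≢b = trans (shadow-other (shadow f a) b v v≢b) (shadow-other f a v v≢a)

shadow-inv : ∀ f y v {w} → shadow f y v ≡ w → w ≢ y → v ≢ y × f v ≡ w
shadow-inv f y v eq w≢y with v ≟ y
... | yes refl = ⊥-elim (w≢y (sym eq))
... | no v≢y   = v≢y , eq

shadow-ext : ∀ {f g} y → (∀ v → f v ≡ g v) → ∀ v → shadow f y v ≡ shadow g y v
shadow-ext y f≗g v with v ≟ y
... | yes _ = refl
... | no _  = f≗g v

rename : (Var → Var) → Term → Term
rename f (var x)         = var (f x)
rename f (lam x M)       = lam x (rename (shadow f x) M)
rename f (app M N)       = app (rename f M) (rename f N)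
rename f (era x M)       = era (f x) (rename f M)
rename f (dup x x₁ x₂ M) = dup (f x) x₁ x₂ (rename (shadow (shadow f x₁) x₂) M)
rename f (sub M x N)     = sub (rename (shadow f x) M) x (rename f N)

rename-ext : ∀ {f g} M → (∀ v → f v ≡ g v) → rename f M ≡ rename g M
rename-ext (var x) f≗g = cong var (f≗g x)
rename-ext (lam x M) f≗g = cong (lam x) (rename-ext M (shadow-ext x f≗g))
rename-ext (app M N) f≗g = cong₂ app (rename-ext M f≗g) (rename-ext N f≗g)
rename-ext (era x M) f≗g = cong₂ era (f≗g x) (rename-ext M f≗g)
rename-ext (dup x x₁ x₂ M) f≗g =
  cong₂ (λ y P → dup y x₁ x₂ P) (f≗g x) (rename-ext M (shadow-ext x₂ (shadow-ext x₁ f≗g)))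
rename-ext (sub M x N) f≗g =
  cong₂ (λ P Q → sub P x Q) (rename-ext M (shadow-ext x f≗g)) (rename-ext N f≗g)

-- The finite-map renaming ren of Defs is rename along lookupRen: dropping
-- a binder from the map is shadowing it.
lookup-hit : ∀ a b ρ v → a ≡ v → lookupRen ((a , b) ∷ ρ) v ≡ b
lookup-hit a b ρ v a≡v with a ≟ v
... | yes _   = refl
... | no a≢v = ⊥-elim (a≢v a≡v)

lookup-miss : ∀ a b ρ v → a ≢ v → lookupRen ((a , b) ∷ ρ) v ≡ lookupRen ρ v
lookup-miss a b ρ v a≢v with a ≟ v
... | yes a≡v = ⊥-elim (a≢v a≡v)
... | no _    = refl

lookup-dropped : ∀ ρ y → lookupRen (dropRen ρ y) y ≡ y
lookup-dropped [] y = refl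
lookup-dropped ((a , b) ∷ ρ) y with a ≟ y
... | yes _ = lookup-dropped ρ y
... | no a≢y = trans (lookup-miss a b (dropRen ρ y) y a≢y) (lookup-dropped ρ y)

lookup-kept : ∀ ρ y v → v ≢ y → lookupRen (dropRen ρ y) v ≡ lookupRen ρ v
lookup-kept [] y v v≢y = refl
lookup-kept ((a , b) ∷ ρ) y v v≢y with a ≟ y
... | yes refl = trans (lookup-kept ρ a v v≢y) (sym (lookup-miss a b ρ v (≢-sym v≢y)))
... | no a≢y with a ≟ v
...   | yes _ = refl
...   | no _  = lookup-kept ρ y v v≢y

lookup-dropRen : ∀ ρ y v → lookupRen (dropRen ρ y) v ≡ shadow (lookupRen ρ) y v
lookup-dropRen ρ y v with ≡-or-≢ v y
... | inj₁ refl = trans (lookup-dropped ρ v) (sym (shadow-self (lookupRen ρ) v))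
... | inj₂ v≢y  = trans (lookup-kept ρ y v v≢y) (sym (shadow-other (lookupRen ρ) y v v≢y))

ren≡rename : ∀ ρ M → ren ρ M ≡ rename (lookupRen ρ) M
ren≡rename ρ (var x) = refl
ren≡rename ρ (lam x M) =
  cong (lam x) (trans (ren≡rename (dropRen ρ x) M) (rename-ext M (lookup-dropRen ρ x)))
ren≡rename ρ (app M N) = cong₂ app (ren≡rename ρ M) (ren≡rename ρ N)
ren≡rename ρ (era x M) = cong (era _) (ren≡rename ρ M)
ren≡rename ρ (dup x x₁ x₂ M) =
  cong (dup _ x₁ x₂) (trans (ren≡rename (dropRen (dropRen ρ x₁) x₂) M) (rename-ext M drop₂))
  where
  drop₂ : ∀ v → lookupRen (dropRen (dropRen ρ x₁) x₂) v ≡ shadow (shadow (lookupRen ρ) x₁) x₂ v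
  drop₂ v = trans (lookup-dropRen (dropRen ρ x₁) x₂ v) (shadow-ext x₂ (lookup-dropRen ρ x₁) v)
ren≡rename ρ (sub M x N) =
  cong₂ (λ P Q → sub P x Q)
    (trans (ren≡rename (dropRen ρ x) M) (rename-ext M (lookup-dropRen ρ x))) (ren≡rename ρ N)

fv⊆vars : ∀ M → fv M ⊆ vars M
fv⊆vars (var x) p = p
fv⊆vars (lam x M) p = there (fv⊆vars M (proj₁ (∈-∖⁻ (fv M) x p)))
fv⊆vars (app M N) p with ∈-++⁻ (fv M) p
... | inj₁ q = ∈-++⁺ˡ (fv⊆vars M q)
... | inj₂ q = ∈-++⁺ʳ (vars M) (fv⊆vars N q)
fv⊆vars (era x M) (here refl) = here refl
fv⊆vars (era x M) (there p) = there (fv⊆vars M p)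
fv⊆vars (dup x x₁ x₂ M) (here refl) = here refl
fv⊆vars (dup x x₁ x₂ M) (there p) =
  there (there (there (fv⊆vars M (proj₁ (∈-∖∖⁻ (fv M) x₁ x₂ p)))))
fv⊆vars (sub M x N) p with ∈-++⁻ (fv M ∖ x) p
... | inj₁ q = there (∈-++⁺ˡ (fv⊆vars M (proj₁ (∈-∖⁻ (fv M) x q))))
... | inj₂ q = there (∈-++⁺ʳ (vars M) (fv⊆vars N q))

-- f is capture-avoiding for the names L: every name it changes lands outside L.
Avoids : (Var → Var) → List Var → Set
Avoids f L = ∀ v → (f v ≡ v) ⊎ (f v ∉ L)

avoids-shadow : ∀ {f L} y → Avoids f L → Avoids (shadow f y) L
avoids-shadow {f} y av v with v ≟ y
... | yes _ = inj₁ refl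
... | no _  = av v

avoids-⊆ : ∀ {f L L'} → L' ⊆ L → Avoids f L → Avoids f L'
avoids-⊆ L'⊆L av v with av v
... | inj₁ fixed = inj₁ fixed
... | inj₂ f∉L  = inj₂ (λ p → f∉L (L'⊆L p))

avoids-≢ : ∀ {f L y v} → Avoids f L → y ∈ L → v ≢ y → f v ≢ y
avoids-≢ {f} {L} {y} {v} av y∈L v≢y fv≡y with av v
... | inj₁ fixed = v≢y (trans (sym fixed) fv≡y)
... | inj₂ f∉L  = f∉L (subst (_∈ L) (sym fv≡y) y∈L)

shadow-reflects : ∀ {f L y} v → Avoids f L → y ∈ L → shadow f y v ≡ y → v ≡ y
shadow-reflects {f} {L} {y} v av y∈L eq with ≡-or-≢ v y
... | inj₁ v≡y = v≡y
... | inj₂ v≢y = ⊥-elim (avoids-≢ av y∈L v≢y (trans (sym (shadow-other f y v v≢y)) eq))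

Image : (Var → Var) → List Var → Var → Set
Image f xs w = Σ Var λ v → v ∈ xs × f v ≡ w

image-++ˡ : ∀ {f xs w} ys → Image f xs w → Image f (xs ++ ys) w
image-++ˡ ys (v , p , eq) = v , ∈-++⁺ˡ p , eq

image-++ʳ : ∀ {f ys w} xs → Image f ys w → Image f (xs ++ ys) w
image-++ʳ xs (v , p , eq) = v , ∈-++⁺ʳ xs p , eq

image-∷ : ∀ {f xs w} x → Image f xs w → Image f (x ∷ xs) w
image-∷ x (v , p , eq) = v , there p , eq

fv-rename⁻ : ∀ M f {w} → w ∈ fv (rename f M) → Image f (fv M) w
fv-rename-under⁻ : ∀ M f a {w} → w ∈ fv (rename (shadow f a) M) ∖ a → Image f (fv M ∖ a) w
fv-rename-under₂⁻ : ∀ M f a b {w} → w ∈ (fv (rename (shadow (shadow f a) b) M) ∖ a) ∖ b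
                  → Image f ((fv M ∖ a) ∖ b) w

fv-rename⁻ (var x) f (here refl) = x , here refl , refl
fv-rename⁻ (lam x M) f p = fv-rename-under⁻ M f x p
fv-rename⁻ (app M N) f p with ∈-++⁻ (fv (rename f M)) p
... | inj₁ q = image-++ˡ (fv N) (fv-rename⁻ M f q)
... | inj₂ q = image-++ʳ (fv M) (fv-rename⁻ N f q)
fv-rename⁻ (era x M) f (here refl) = x , here refl , refl
fv-rename⁻ (era x M) f (there q) = image-∷ x (fv-rename⁻ M f q)
fv-rename⁻ (dup x x₁ x₂ M) f (here refl) = x , here refl , refl
fv-rename⁻ (dup x x₁ x₂ M) f (there p) = image-∷ x (fv-rename-under₂⁻ M f x₁ x₂ p)
fv-rename⁻ (sub M x N) f p with ∈-++⁻ (fv (rename (shadow f x) M) ∖ x) p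
... | inj₁ q = image-++ˡ (fv N) (fv-rename-under⁻ M f x q)
... | inj₂ q = image-++ʳ (fv M ∖ x) (fv-rename⁻ N f q)

fv-rename-under⁻ M f a p with ∈-∖⁻ (fv (rename (shadow f a) M)) a p
... | q , w≢a with fv-rename⁻ M (shadow f a) q
... | v , v∈M , eq with shadow-inv f a v eq w≢a
... | v≢a , eq' = v , ∈-∖⁺ (fv M) a v∈M v≢a , eq'

fv-rename-under₂⁻ M f a b p with ∈-∖∖⁻ (fv (rename (shadow (shadow f a) b) M)) a b p
... | q , w≢a , w≢b with fv-rename⁻ M (shadow (shadow f a) b) q
... | v , v∈M , eq with shadow-inv (shadow f a) b v eq w≢b
... | v≢b , eq' with shadow-inv f a v eq' w≢a
... | v≢a , eq'' = v , ∈-∖∖⁺ (fv M) a b v∈M v≢a v≢b , eq''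

fv-rename⁺ : ∀ M f {v} → Avoids f (vars M) → v ∈ fv M → f v ∈ fv (rename f M)
fv-rename-under⁺ : ∀ M f a {v} → Avoids f (a ∷ vars M) → v ∈ fv M ∖ a
                 → f v ∈ fv (rename (shadow f a) M) ∖ a
fv-rename-under₂⁺ : ∀ M f a b {v} → Avoids f (a ∷ b ∷ vars M) → v ∈ (fv M ∖ a) ∖ b
                  → f v ∈ (fv (rename (shadow (shadow f a) b) M) ∖ a) ∖ b

fv-rename⁺ (var x) f av (here refl) = here refl
fv-rename⁺ (lam x M) f av p = fv-rename-under⁺ M f x av p
fv-rename⁺ (app M N) f av p with ∈-++⁻ (fv M) p
... | inj₁ q = ∈-++⁺ˡ (fv-rename⁺ M f (avoids-⊆ ∈-++⁺ˡ av) q)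
... | inj₂ q = ∈-++⁺ʳ _ (fv-rename⁺ N f (avoids-⊆ (∈-++⁺ʳ (vars M)) av) q)
fv-rename⁺ (era x M) f av (here refl) = here refl
fv-rename⁺ (era x M) f av (there q) = there (fv-rename⁺ M f (avoids-⊆ there av) q)
fv-rename⁺ (dup x x₁ x₂ M) f av (here refl) = here refl
fv-rename⁺ (dup x x₁ x₂ M) f av (there p) = there (fv-rename-under₂⁺ M f x₁ x₂ (avoids-⊆ there av) p)
fv-rename⁺ (sub M x N) f av p with ∈-++⁻ (fv M ∖ x) p
... | inj₁ q = ∈-++⁺ˡ (fv-rename-under⁺ M f x (avoids-⊆ (∷⁺ʳ x ∈-++⁺ˡ) av) q)
... | inj₂ q = ∈-++⁺ʳ _ (fv-rename⁺ N f (avoids-⊆ (λ r → there (∈-++⁺ʳ (vars M) r)) av) q)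

fv-rename-under⁺ M f a {v} av p with ∈-∖⁻ (fv M) a p
... | q , v≢a =
  ∈-∖⁺ _ a (subst (_∈ fv (rename (shadow f a) M)) (shadow-other f a v v≢a)
              (fv-rename⁺ M (shadow f a) (avoids-shadow a (avoids-⊆ there av)) q))
         (avoids-≢ av (here refl) v≢a)

fv-rename-under₂⁺ M f a b {v} av p with ∈-∖∖⁻ (fv M) a b p
... | q , v≢a , v≢b =
  ∈-∖∖⁺ _ a b
    (subst (_∈ fv (rename g M)) (shadow₂-other f a b v v≢a v≢b)
      (fv-rename⁺ M g (avoids-shadow b (avoids-shadow a (avoids-⊆ (λ r → there (there r)) av))) q))
    (avoids-≢ av (here refl) v≢a) (avoids-≢ av (there (here refl)) v≢b)
  where
  g : Var → Var
  g = shadow (shadow f a) b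

-- Substitution-free terms

NoSub : Term → Set
NoSub (var x)         = ⊤
NoSub (lam x M)       = NoSub M
NoSub (app M N)       = NoSub M × NoSub N
NoSub (era x M)       = NoSub M
NoSub (dup x x₁ x₂ M) = NoSub M
NoSub (sub M x N)     = ⊥

WF⇒WFs : ∀ {M} → WF M → WFs M
WF⇒WFs (wf-var x) = wfs-var x
WF⇒WFs (wf-lam x M w p) = wfs-lam x M (WF⇒WFs w) p
WF⇒WFs (wf-app M N w v d) = wfs-app M N (WF⇒WFs w) (WF⇒WFs v) d
WF⇒WFs (wf-era x M w p) = wfs-era x M (WF⇒WFs w) p
WF⇒WFs (wf-dup x x₁ x₂ M w a b c d) = wfs-dup x x₁ x₂ M (WF⇒WFs w) a b c d

WF⇒NoSub : ∀ {M} → WF M → NoSub M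
WF⇒NoSub (wf-var x) = tt
WF⇒NoSub (wf-lam x M w p) = WF⇒NoSub w
WF⇒NoSub (wf-app M N w v d) = WF⇒NoSub w , WF⇒NoSub v
WF⇒NoSub (wf-era x M w p) = WF⇒NoSub w
WF⇒NoSub (wf-dup x x₁ x₂ M w a b c d) = WF⇒NoSub w

WFs∧NoSub⇒WF : ∀ {M} → WFs M → NoSub M → WF M
WFs∧NoSub⇒WF (wfs-var x) _ = wf-var x
WFs∧NoSub⇒WF (wfs-lam x M w p) ns = wf-lam x M (WFs∧NoSub⇒WF w ns) p
WFs∧NoSub⇒WF (wfs-app M N w v d) (ns , ns') =
  wf-app M N (WFs∧NoSub⇒WF w ns) (WFs∧NoSub⇒WF v ns') d
WFs∧NoSub⇒WF (wfs-era x M w p) ns = wf-era x M (WFs∧NoSub⇒WF w ns) p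
WFs∧NoSub⇒WF (wfs-dup x x₁ x₂ M w a b c d) ns =
  wf-dup x x₁ x₂ M (WFs∧NoSub⇒WF w ns) a b c d

NoSub-rename⁺ : ∀ M f → NoSub M → NoSub (rename f M)
NoSub-rename⁺ (var x) f ns = tt
NoSub-rename⁺ (lam x M) f ns = NoSub-rename⁺ M _ ns
NoSub-rename⁺ (app M N) f (ns , ns') = NoSub-rename⁺ M f ns , NoSub-rename⁺ N f ns'
NoSub-rename⁺ (era x M) f ns = NoSub-rename⁺ M f ns
NoSub-rename⁺ (dup x x₁ x₂ M) f ns = NoSub-rename⁺ M _ ns

NoSub-rename⁻ : ∀ M f → NoSub (rename f M) → NoSub M
NoSub-rename⁻ (var x) f ns = tt
NoSub-rename⁻ (lam x M) f ns = NoSub-rename⁻ M _ ns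
NoSub-rename⁻ (app M N) f (ns , ns') = NoSub-rename⁻ M f ns , NoSub-rename⁻ N f ns'
NoSub-rename⁻ (era x M) f ns = NoSub-rename⁻ M f ns
NoSub-rename⁻ (dup x x₁ x₂ M) f ns = NoSub-rename⁻ M _ ns

InjectiveOn : (Var → Var) → List Var → Set
InjectiveOn f xs = ∀ {v w} → v ∈ xs → w ∈ xs → f v ≡ f w → v ≡ w

injectiveOn-⊆ : ∀ {f xs ys} → ys ⊆ xs → InjectiveOn f xs → InjectiveOn f ys
injectiveOn-⊆ ys⊆xs inj p q = inj (ys⊆xs p) (ys⊆xs q)

injectiveOn-shadow : ∀ {f L K} y → InjectiveOn f L → (∀ {v} → v ∈ K → v ≢ y → v ∈ L)
                   → (∀ v → v ≢ y → f v ≢ y) → InjectiveOn (shadow f y) K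
injectiveOn-shadow {f} y inj K∖y⊆L keeps {v} {w} p q eq with ≡-or-≢ v y | ≡-or-≢ w y
... | inj₁ refl | inj₁ refl = refl
... | inj₁ refl | inj₂ w≢y =
  ⊥-elim (keeps w w≢y (sym (trans (sym (shadow-self f v)) (trans eq (shadow-other f v w w≢y)))))
... | inj₂ v≢y | inj₁ refl =
  ⊥-elim (keeps v v≢y (trans (sym (shadow-other f w v v≢y)) (trans eq (shadow-self f w))))
... | inj₂ v≢y | inj₂ w≢y =
  inj (K∖y⊆L p v≢y) (K∖y⊆L q w≢y)
      (trans (sym (shadow-other f y v v≢y)) (trans eq (shadow-other f y w w≢y)))

disjoint-image : ∀ {f L xs ys xs' ys'} → InjectiveOn f L → xs ⊆ L → ys ⊆ L → Disjoint xs ys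
               → (∀ {w} → w ∈ xs' → Image f xs w) → (∀ {w} → w ∈ ys' → Image f ys w)
               → Disjoint xs' ys'
disjoint-image inj xs⊆L ys⊆L disj imxs imys (p , q) with imxs p | imys q
... | v , v∈xs , refl | v' , v'∈ys , eq with inj (xs⊆L v∈xs) (ys⊆L v'∈ys) (sym eq)
... | refl = disj (v∈xs , v'∈ys)

WFs-rename : ∀ M f → Avoids f (vars M) → InjectiveOn f (fv M) → WFs M → WFs (rename f M)
WFs-rename (var x) f av inj w = wfs-var (f x)
WFs-rename (lam x M) f av inj (wfs-lam _ _ w x∈M) =
  wfs-lam x _ (WFs-rename M (shadow f x) av' inj' w)
    (subst (_∈ fv (rename (shadow f x) M)) (shadow-self f x) (fv-rename⁺ M (shadow f x) av' x∈M))
  where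
  av' : Avoids (shadow f x) (vars M)
  av' = avoids-shadow x (avoids-⊆ there av)
  inj' : InjectiveOn (shadow f x) (fv M)
  inj' = injectiveOn-shadow x inj (∈-∖⁺ (fv M) x) (λ v v≢x → avoids-≢ av (here refl) v≢x)
WFs-rename (app M N) f av inj (wfs-app _ _ w w' disj) =
  wfs-app _ _ (WFs-rename M f (avoids-⊆ ∈-++⁺ˡ av) (injectiveOn-⊆ ∈-++⁺ˡ inj) w)
              (WFs-rename N f (avoids-⊆ (∈-++⁺ʳ (vars M)) av) (injectiveOn-⊆ (∈-++⁺ʳ (fv M)) inj) w')
              (disjoint-image inj ∈-++⁺ˡ (∈-++⁺ʳ (fv M)) disj (fv-rename⁻ M f) (fv-rename⁻ N f))
WFs-rename (era x M) f av inj (wfs-era _ _ w x∉M) =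
  wfs-era (f x) _ (WFs-rename M f (avoids-⊆ there av) (injectiveOn-⊆ there inj) w) fx∉
  where
  fx∉ : f x ∉ fv (rename f M)
  fx∉ p with fv-rename⁻ M f p
  ... | v , v∈M , eq with inj (there v∈M) (here refl) eq
  ... | refl = x∉M v∈M
WFs-rename (dup x x₁ x₂ M) f av inj (wfs-dup _ _ _ _ w x₁∈M x₂∈M x₁≢x₂ x∉) =
  wfs-dup (f x) x₁ x₂ _ (WFs-rename M g avg injg w)
    (subst (_∈ fv (rename g M)) (trans (shadow-other (shadow f x₁) x₂ x₁ x₁≢x₂) (shadow-self f x₁))
      (fv-rename⁺ M g avg x₁∈M))
    (subst (_∈ fv (rename g M)) (shadow-self (shadow f x₁) x₂) (fv-rename⁺ M g avg x₂∈M))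
    x₁≢x₂ fx∉
  where
  g : Var → Var
  g = shadow (shadow f x₁) x₂
  avg : Avoids g (vars M)
  avg = avoids-shadow x₂ (avoids-shadow x₁ (avoids-⊆ (λ r → there (there (there r))) av))
  inj₁' : InjectiveOn (shadow f x₁) (fv M ∖ x₂)
  inj₁' = injectiveOn-shadow x₁ inj
            (λ p v≢x₁ → let q , v≢x₂ = ∈-∖⁻ (fv M) x₂ p in
                        there (∈-∖∖⁺ (fv M) x₁ x₂ q v≢x₁ v≢x₂))
            (λ v v≢x₁ → avoids-≢ av (there (here refl)) v≢x₁)
  injg : InjectiveOn g (fv M)
  injg = injectiveOn-shadow x₂ inj₁' (∈-∖⁺ (fv M) x₂)
           (λ v v≢x₂ → avoids-≢ (avoids-shadow x₁ av) (there (there (here refl))) v≢x₂)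
  fx∉ : f x ∉ (fv (rename g M) ∖ x₁) ∖ x₂
  fx∉ p with fv-rename-under₂⁻ M f x₁ x₂ p
  ... | v , v∈ , eq with inj (there v∈) (here refl) eq
  ... | refl = x∉ v∈
WFs-rename (sub M x N) f av inj (wfs-sub _ _ _ w x∈M wfN disj) =
  wfs-sub _ x _ (WFs-rename M (shadow f x) avM injM w)
    (subst (_∈ fv (rename (shadow f x) M)) (shadow-self f x) (fv-rename⁺ M (shadow f x) avM x∈M))
    (WFs∧NoSub⇒WF (WFs-rename N f avN injN (WF⇒WFs wfN)) (NoSub-rename⁺ N f (WF⇒NoSub wfN)))
    (disjoint-image inj ∈-++⁺ˡ (∈-++⁺ʳ (fv M ∖ x)) disj (fv-rename-under⁻ M f x) (fv-rename⁻ N f))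
  where
  avM : Avoids (shadow f x) (vars M)
  avM = avoids-shadow x (avoids-⊆ (λ r → there (∈-++⁺ˡ r)) av)
  avN : Avoids f (vars N)
  avN = avoids-⊆ (λ r → there (∈-++⁺ʳ (vars M) r)) av
  injM : InjectiveOn (shadow f x) (fv M)
  injM = injectiveOn-shadow x inj (λ p v≢x → ∈-++⁺ˡ (∈-∖⁺ (fv M) x p v≢x))
           (λ v v≢x → avoids-≢ av (here refl) v≢x)
  injN : InjectiveOn f (fv N)
  injN = injectiveOn-⊆ (∈-++⁺ʳ (fv M ∖ x)) inj

WF-rename : ∀ N f → Avoids f (vars N) → InjectiveOn f (fv N) → WF N → WF (rename f N)
WF-rename N f av inj wfN =
  WFs∧NoSub⇒WF (WFs-rename N f av inj (WF⇒WFs wfN)) (NoSub-rename⁺ N f (WF⇒NoSub wfN))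

-- Reflection needs no injectivity: an avoiding renaming cannot merge
-- variables that were apart, since it only introduces names absent from M.
WFs-unrename : ∀ M f → Avoids f (vars M) → WFs (rename f M) → WFs M
WFs-unrename (var x) f av w = wfs-var x
WFs-unrename (lam x M) f av (wfs-lam _ _ w x∈) with fv-rename⁻ M (shadow f x) x∈
... | v , v∈M , eq with shadow-reflects v av (here refl) eq
... | refl = wfs-lam x M (WFs-unrename M (shadow f x) (avoids-shadow x (avoids-⊆ there av)) w) v∈M
WFs-unrename (app M N) f av (wfs-app _ _ w w' disj) =
  wfs-app M N (WFs-unrename M f avM w) (WFs-unrename N f avN w')
    (λ (p , q) → disj (fv-rename⁺ M f avM p , fv-rename⁺ N f avN q))
  where
  avM : Avoids f (vars M)
  avM = avoids-⊆ ∈-++⁺ˡ av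
  avN : Avoids f (vars N)
  avN = avoids-⊆ (∈-++⁺ʳ (vars M)) av
WFs-unrename (era x M) f av (wfs-era _ _ w fx∉) =
  wfs-era x M (WFs-unrename M f (avoids-⊆ there av) w) (λ p → fx∉ (fv-rename⁺ M f (avoids-⊆ there av) p))
WFs-unrename (dup x x₁ x₂ M) f av (wfs-dup _ _ _ _ w x₁∈ x₂∈ x₁≢x₂ fx∉) =
  wfs-dup x x₁ x₂ M (WFs-unrename M g avg w) x₁∈M x₂∈M x₁≢x₂ x∉
  where
  g : Var → Var
  g = shadow (shadow f x₁) x₂
  avg : Avoids g (vars M)
  avg = avoids-shadow x₂ (avoids-shadow x₁ (avoids-⊆ (λ r → there (there (there r))) av))
  x₁∈M : x₁ ∈ fv M
  x₁∈M with fv-rename⁻ M g x₁∈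
  ... | v , v∈M , eq with ≡-or-≢ v x₂
  ... | inj₁ refl = ⊥-elim (x₁≢x₂ (trans (sym eq) (shadow-self (shadow f x₁) v)))
  ... | inj₂ v≢x₂
      with shadow-reflects v av (there (here refl)) (trans (sym (shadow-other (shadow f x₁) x₂ v v≢x₂)) eq)
  ... | refl = v∈M
  x₂∈M : x₂ ∈ fv M
  x₂∈M with fv-rename⁻ M g x₂∈
  ... | v , v∈M , eq with shadow-reflects v (avoids-shadow x₁ av) (there (there (here refl))) eq
  ... | refl = v∈M
  x∉ : x ∉ (fv M ∖ x₁) ∖ x₂
  x∉ p = fx∉ (fv-rename-under₂⁺ M f x₁ x₂ (avoids-⊆ there av) p)
WFs-unrename (sub M x N) f av (wfs-sub _ _ _ w x∈ wfN disj) with fv-rename⁻ M (shadow f x) x∈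
... | v , v∈M , eq with shadow-reflects v av (here refl) eq
... | refl =
  wfs-sub M x N (WFs-unrename M (shadow f x) avM w) v∈M
    (WFs∧NoSub⇒WF (WFs-unrename N f avN (WF⇒WFs wfN)) (NoSub-rename⁻ N f (WF⇒NoSub wfN)))
    (λ (p , q) → disj (fv-rename-under⁺ M f x (avoids-⊆ (∷⁺ʳ x ∈-++⁺ˡ) av) p ,
                       fv-rename⁺ N f avN q))
  where
  avM : Avoids (shadow f x) (vars M)
  avM = avoids-shadow x (avoids-⊆ (λ r → there (∈-++⁺ˡ r)) av)
  avN : Avoids f (vars N)
  avN = avoids-⊆ (λ r → there (∈-++⁺ʳ (vars M) r)) av

Preserves : Term → Term → Set
Preserves M N = WFs M → WFs N × fv M ≃ fv N

preserves-trans : ∀ {M N P} → Preserves M N → Preserves N P → Preserves M P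
preserves-trans M⇒N N⇒P wM with M⇒N wM
... | wN , fvM≃fvN with N⇒P wN
... | wP , fvN≃fvP = wP , ≃-trans fvM≃fvN fvN≃fvP

-- Since the side conditions of WFs only mention free-variable sets, a
-- replacement preserving both may be performed inside any context.
preserves-lam : ∀ {x M M'} → Preserves M M' → Preserves (lam x M) (lam x M')
preserves-lam {x} M⇒M' (wfs-lam _ _ wM x∈M) with M⇒M' wM
... | wM' , M≃M' = wfs-lam _ _ wM' (proj₁ M≃M' x∈M) , ∖-cong x M≃M'

preserves-appl : ∀ {M M' N} → Preserves M M' → Preserves (app M N) (app M' N)
preserves-appl M⇒M' (wfs-app _ _ wM wN disj) with M⇒M' wM
... | wM' , M≃M' = wfs-app _ _ wM' wN (disjoint-mono (proj₂ M≃M') ⊆-refl disj) , ++-cong M≃M' ≃-refl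

preserves-appr : ∀ {M N N'} → Preserves N N' → Preserves (app M N) (app M N')
preserves-appr N⇒N' (wfs-app _ _ wM wN disj) with N⇒N' wN
... | wN' , N≃N' = wfs-app _ _ wM wN' (disjoint-mono ⊆-refl (proj₂ N≃N') disj) , ++-cong ≃-refl N≃N'

preserves-era : ∀ {x M M'} → Preserves M M' → Preserves (era x M) (era x M')
preserves-era M⇒M' (wfs-era _ _ wM x∉M) with M⇒M' wM
... | wM' , M≃M' = wfs-era _ _ wM' (λ p → x∉M (proj₂ M≃M' p)) , ∷-cong M≃M'

preserves-dup : ∀ {x x₁ x₂ M M'} → Preserves M M' → Preserves (dup x x₁ x₂ M) (dup x x₁ x₂ M')
preserves-dup {x₁ = x₁} {x₂} M⇒M' (wfs-dup _ _ _ _ wM x₁∈M x₂∈M x₁≢x₂ x∉) with M⇒M' wM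
... | wM' , M≃M' =
  wfs-dup _ _ _ _ wM' (proj₁ M≃M' x₁∈M) (proj₁ M≃M' x₂∈M) x₁≢x₂
    (λ p → x∉ (∖-mono x₂ (∖-mono x₁ (proj₂ M≃M')) p)) ,
  ∷-cong (∖-cong x₂ (∖-cong x₁ M≃M'))

preserves-subl : ∀ {M M' x N} → Preserves M M' → Preserves (sub M x N) (sub M' x N)
preserves-subl {x = x} M⇒M' (wfs-sub _ _ _ wM x∈M wN disj) with M⇒M' wM
... | wM' , M≃M' =
  wfs-sub _ _ _ wM' (proj₁ M≃M' x∈M) wN (disjoint-mono (∖-mono x (proj₂ M≃M')) ⊆-refl disj) ,
  ++-cong (∖-cong x M≃M') ≃-refl

-- The substituted term ranges over Λ_®, so here the replacement must keep WF.
preserves-subr : ∀ {M x N N'} → (WF N → WF N' × fv N ≃ fv N')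
               → Preserves (sub M x N) (sub M x N')
preserves-subr {M} {x} N⇒N' (wfs-sub _ _ _ wM x∈M wN disj) with N⇒N' wN
... | wN' , N≃N' =
  wfs-sub _ _ _ wM x∈M wN' (disjoint-mono ⊆-refl (proj₂ N≃N') disj) , ++-cong (≃-refl {fv M ∖ x}) N≃N'

-- α-equivalent terms agree on well-formedness, free variables and NoSub

[_↦_] : Var → Var → Var → Var
[ a ↦ b ] = lookupRen ((a , b) ∷ [])

↦-hit : ∀ a b → [ a ↦ b ] a ≡ b
↦-hit a b = lookup-hit a b [] a refl

↦-miss : ∀ a b v → a ≢ v → [ a ↦ b ] v ≡ v
↦-miss a b v a≢v = lookup-miss a b [] v a≢v

avoids-↦ : ∀ {L} a b → b ∉ L → Avoids [ a ↦ b ] L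
avoids-↦ a b b∉L v with ≡-or-≢ a v
... | inj₁ refl = inj₂ (subst (_∉ _) (sym (↦-hit a b)) b∉L)
... | inj₂ a≢v  = inj₁ (↦-miss a b v a≢v)

injectiveOn-↦ : ∀ {xs} a b → b ∉ xs → InjectiveOn [ a ↦ b ] xs
injectiveOn-↦ a b b∉xs {v} {w} p q eq with ≡-or-≢ a v | ≡-or-≢ a w
... | inj₁ refl | inj₁ refl = refl
... | inj₁ refl | inj₂ a≢w =
  ⊥-elim (b∉xs (subst (_∈ _) (trans (sym (↦-miss a b w a≢w)) (trans (sym eq) (↦-hit a b))) q))
... | inj₂ a≢v | inj₁ refl =
  ⊥-elim (b∉xs (subst (_∈ _) (trans (sym (↦-miss a b v a≢v)) (trans eq (↦-hit a b))) p))
... | inj₂ a≢v | inj₂ a≢w = trans (sym (↦-miss a b v a≢v)) (trans eq (↦-miss a b w a≢w))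

module FreshRenaming (M : Term) (a b : Var) (b∉M : b ∉ vars M) where
  M' : Term
  M' = rename [ a ↦ b ] M

  b∉fv : ∀ {w} → w ∈ fv M → w ≢ b
  b∉fv w∈M refl = b∉M (fv⊆vars M w∈M)

  av : Avoids [ a ↦ b ] (vars M)
  av = avoids-↦ a b b∉M

  fv-kept : ∀ {w} → w ∈ fv M → w ≢ a → w ∈ fv M'
  fv-kept {w} w∈M w≢a = subst (_∈ fv M') (↦-miss a b w (≢-sym w≢a)) (fv-rename⁺ M [ a ↦ b ] av w∈M)

  fv-kept⁻ : ∀ {w} → w ∈ fv M' → w ≢ b → w ∈ fv M × w ≢ a
  fv-kept⁻ w∈M' w≢b with fv-rename⁻ M [ a ↦ b ] w∈M'
  ... | v , v∈M , eq with ≡-or-≢ a v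
  ...   | inj₁ refl = ⊥-elim (w≢b (trans (sym eq) (↦-hit a b)))
  ...   | inj₂ a≢v with trans (sym (↦-miss a b v a≢v)) eq
  ...     | refl = v∈M , ≢-sym a≢v

  fv-renamed : a ∈ fv M → b ∈ fv M'
  fv-renamed a∈M = subst (_∈ fv M') (↦-hit a b) (fv-rename⁺ M [ a ↦ b ] av a∈M)

  fv-renamed⁻ : b ∈ fv M' → a ∈ fv M
  fv-renamed⁻ b∈M' with fv-rename⁻ M [ a ↦ b ] b∈M'
  ... | v , v∈M , eq with ≡-or-≢ a v
  ...   | inj₁ refl = v∈M
  ...   | inj₂ a≢v = ⊥-elim (b∉fv v∈M (trans (sym (↦-miss a b v a≢v)) eq))

  fv-∖≃ : fv M ∖ a ≃ fv M' ∖ b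
  fv-∖≃ = (λ p → let q , w≢a = ∈-∖⁻ (fv M) a p in ∈-∖⁺ _ b (fv-kept q w≢a) (b∉fv q)) ,
          (λ p → let q , w≢b = ∈-∖⁻ _ b p ; r , w≢a = fv-kept⁻ q w≢b in ∈-∖⁺ (fv M) a r w≢a)

  wfs⁺ : WFs M → WFs M'
  wfs⁺ = WFs-rename M [ a ↦ b ] av (injectiveOn-↦ a b (λ p → b∉fv p refl))

  wfs⁻ : WFs M' → WFs M
  wfs⁻ = WFs-unrename M [ a ↦ b ] av

record Agree (M N : Term) : Set where
  field
    forth        : Preserves M N
    back         : Preserves N M
    noSub-forth  : NoSub M → NoSub N
    noSub-back   : NoSub N → NoSub M

open Agree

agree : ∀ {M N} → (WFs M → WFs N) → (WFs N → WFs M) → fv M ≃ fv N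
      → (NoSub M → NoSub N) → (NoSub N → NoSub M) → Agree M N
agree wfs⇒ wfs⇐ M≃N ns⇒ ns⇐ =
  record { forth = λ w → wfs⇒ w , M≃N ; back = λ w → wfs⇐ w , ≃-sym M≃N
         ; noSub-forth = ns⇒ ; noSub-back = ns⇐ }

agree-refl : ∀ {M} → Agree M M
agree-refl = agree (λ w → w) (λ w → w) ≃-refl (λ ns → ns) (λ ns → ns)

agree-sym : ∀ {M N} → Agree M N → Agree N M
agree-sym M~N = record { forth = back M~N ; back = forth M~N
                       ; noSub-forth = noSub-back M~N ; noSub-back = noSub-forth M~N }

agree-trans : ∀ {M N P} → Agree M N → Agree N P → Agree M P
agree-trans M~N N~P =
  record { forth = preserves-trans (forth M~N) (forth N~P)
         ; back = preserves-trans (back N~P) (back M~N)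
         ; noSub-forth = λ ns → noSub-forth N~P (noSub-forth M~N ns)
         ; noSub-back = λ ns → noSub-back M~N (noSub-back N~P ns) }

agree-cong : ∀ {M N} (C : Term → Term)
           → (∀ {A B} → Agree A B → Preserves (C A) (C B))
           → (∀ {A B} → (NoSub A → NoSub B) → NoSub (C A) → NoSub (C B))
           → Agree M N → Agree (C M) (C N)
agree-cong C preserves-C noSub-C M~N =
  record { forth = preserves-C M~N ; back = preserves-C (agree-sym M~N)
         ; noSub-forth = noSub-C (noSub-forth M~N) ; noSub-back = noSub-C (noSub-back M~N) }

agree-WF : ∀ {N N'} → Agree N N' → WF N → WF N' × fv N ≃ fv N'
agree-WF N~N' wN with forth N~N' (WF⇒WFs wN)
... | wN' , N≃N' = WFs∧NoSub⇒WF wN' (noSub-forth N~N' (WF⇒NoSub wN)) , N≃N'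

agree-α-lam : ∀ x x' M → x' ∉ vars M → Agree (lam x M) (lam x' (rename [ x ↦ x' ] M))
agree-α-lam x x' M x'∉M =
  agree (λ { (wfs-lam _ _ w x∈M) → wfs-lam x' _ (wfs⁺ w) (fv-renamed x∈M) })
        (λ { (wfs-lam _ _ w x'∈M') → wfs-lam x M (wfs⁻ w) (fv-renamed⁻ x'∈M') })
        fv-∖≃ (NoSub-rename⁺ M _) (NoSub-rename⁻ M _)
  where open FreshRenaming M x x' x'∉M

agree-α-dup₁ : ∀ x x₁ x₁' x₂ M → x₁' ∉ vars M → x₁' ≢ x → x₁' ≢ x₂
             → Agree (dup x x₁ x₂ M) (dup x x₁' x₂ (rename [ x₁ ↦ x₁' ] M))
agree-α-dup₁ x x₁ x₁' x₂ M x₁'∉M x₁'≢x x₁'≢x₂ =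
  agree (λ { (wfs-dup _ _ _ _ w x₁∈M x₂∈M x₁≢x₂ x∉) →
               wfs-dup x x₁' x₂ _ (wfs⁺ w) (fv-renamed x₁∈M) (fv-kept x₂∈M (≢-sym x₁≢x₂))
                 x₁'≢x₂
                 (λ p → x∉ (∖-mono x₂ (proj₂ fv-∖≃) p)) })
        (λ { (wfs-dup _ _ _ _ w x₁'∈M' x₂∈M' _ x∉) →
               let x₂∈M , x₂≢x₁ = fv-kept⁻ x₂∈M' (≢-sym x₁'≢x₂) in
               wfs-dup x x₁ x₂ M (wfs⁻ w) (fv-renamed⁻ x₁'∈M') x₂∈M (≢-sym x₂≢x₁)
                 (λ p → x∉ (∖-mono x₂ (proj₁ fv-∖≃) p)) })
        (∷-cong (∖-cong x₂ fv-∖≃)) (NoSub-rename⁺ M _) (NoSub-rename⁻ M _)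
  where open FreshRenaming M x₁ x₁' x₁'∉M

-- The two names introduced by a duplication play symmetric roles, which
-- reduces the renaming of the second one to that of the first.
∖-comm : ∀ xs a b → (xs ∖ a) ∖ b ⊆ (xs ∖ b) ∖ a
∖-comm xs a b p = let q , v≢a , v≢b = ∈-∖∖⁻ xs a b p in ∈-∖∖⁺ xs b a q v≢b v≢a

agree-dup-swap : ∀ x x₁ x₂ M → Agree (dup x x₁ x₂ M) (dup x x₂ x₁ M)
agree-dup-swap x x₁ x₂ M =
  agree swap swap (∷-cong (∖-comm (fv M) x₁ x₂ , ∖-comm (fv M) x₂ x₁)) (λ ns → ns) (λ ns → ns)
  where
  swap : ∀ {a b} → WFs (dup x a b M) → WFs (dup x b a M)
  swap {a} {b} (wfs-dup _ _ _ _ w a∈M b∈M a≢b x∉) =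
    wfs-dup x b a M w b∈M a∈M (≢-sym a≢b) (λ p → x∉ (∖-comm (fv M) b a p))

agree-α-dup₂ : ∀ x x₁ x₂ x₂' M → x₂' ∉ vars M → x₂' ≢ x → x₂' ≢ x₁
             → Agree (dup x x₁ x₂ M) (dup x x₁ x₂' (rename [ x₂ ↦ x₂' ] M))
agree-α-dup₂ x x₁ x₂ x₂' M x₂'∉M x₂'≢x x₂'≢x₁ =
  agree-trans (agree-dup-swap x x₁ x₂ M)
    (agree-trans (agree-α-dup₁ x x₂ x₂' x₁ M x₂'∉M x₂'≢x x₂'≢x₁)
      (agree-dup-swap x x₂' x₁ _))

agree-α-sub : ∀ M x x' N → x' ∉ vars M → Agree (sub M x N) (sub (rename [ x ↦ x' ] M) x' N)
agree-α-sub M x x' N x'∉M =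
  agree (λ { (wfs-sub _ _ _ w x∈M wN disj) →
               wfs-sub _ x' N (wfs⁺ w) (fv-renamed x∈M) wN
                 (disjoint-mono (proj₂ fv-∖≃) ⊆-refl disj) })
        (λ { (wfs-sub _ _ _ w x'∈M' wN disj) →
               wfs-sub M x N (wfs⁻ w) (fv-renamed⁻ x'∈M') wN
                 (disjoint-mono (proj₁ fv-∖≃) ⊆-refl disj) })
        (++-cong fv-∖≃ ≃-refl) (λ ()) (λ ())
  where open FreshRenaming M x x' x'∉M

agree-α₁ : ∀ {M N} → M α₁ N → Agree M N
agree-α₁ (α-lam x x' M x'∉M) rewrite ren≡rename ((x , x') ∷ []) M = agree-α-lam x x' M x'∉M
agree-α₁ (α-dup₁ x x₁ x₁' x₂ M fresh x₁'≢x x₁'≢x₂) rewrite ren≡rename ((x₁ , x₁') ∷ []) M =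
  agree-α-dup₁ x x₁ x₁' x₂ M fresh x₁'≢x x₁'≢x₂
agree-α₁ (α-dup₂ x x₁ x₂ x₂' M fresh x₂'≢x x₂'≢x₁) rewrite ren≡rename ((x₂ , x₂') ∷ []) M =
  agree-α-dup₂ x x₁ x₂ x₂' M fresh x₂'≢x x₂'≢x₁
agree-α₁ (α-sub M x x' N x'∉M _) rewrite ren≡rename ((x , x') ∷ []) M = agree-α-sub M x x' N x'∉M

agree-α : ∀ {M N} → M ≡α N → Agree M N
agree-α (α-step s) = agree-α₁ s
agree-α α-refl = agree-refl
agree-α (α-sym M≡N) = agree-sym (agree-α M≡N)
agree-α (α-trans M≡N N≡P) = agree-trans (agree-α M≡N) (agree-α N≡P)
agree-α (α-cλ {x} M≡N) =
  agree-cong (lam x) (λ a → preserves-lam (forth a)) (λ ns → ns) (agree-α M≡N)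
agree-α (α-cappl {N = P} M≡N) =
  agree-cong (λ A → app A P) (λ a → preserves-appl (forth a))
    (λ { ns (nsA , nsP) → ns nsA , nsP }) (agree-α M≡N)
agree-α (α-cappr {M = P} M≡N) =
  agree-cong (app P) (λ a → preserves-appr (forth a))
    (λ { ns (nsP , nsA) → nsP , ns nsA }) (agree-α M≡N)
agree-α (α-cera {x} M≡N) =
  agree-cong (era x) (λ a → preserves-era (forth a)) (λ ns → ns) (agree-α M≡N)
agree-α (α-cdup {x} {x₁} {x₂} M≡N) =
  agree-cong (dup x x₁ x₂) (λ a → preserves-dup (forth a)) (λ ns → ns) (agree-α M≡N)
agree-α (α-csubl {x = x} {N = P} M≡N) =
  agree-cong (λ A → sub A x P) (λ a → preserves-subl (forth a)) (λ _ ()) (agree-α M≡N)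
agree-α (α-csubr {M = P} {x = x} M≡N) =
  agree-cong (sub P x) (λ a → preserves-subr (agree-WF a)) (λ _ ()) (agree-α M≡N)

unique-fv : ∀ {M} → WFs M → Unique (fv M)
unique-fv (wfs-var x) = unique-∷ (λ ()) []
unique-fv (wfs-lam x M w _) = unique-∖ (fv M) x (unique-fv w)
unique-fv (wfs-app M N w w' disj) = unique-++ (unique-fv w) (unique-fv w') disj
unique-fv (wfs-era x M w x∉M) = unique-∷ x∉M (unique-fv w)
unique-fv (wfs-dup x x₁ x₂ M w _ _ _ x∉) =
  unique-∷ x∉ (unique-∖ _ x₂ (unique-∖ (fv M) x₁ (unique-fv w)))
unique-fv (wfs-sub M x N w _ wN disj) =
  unique-++ (unique-∖ (fv M) x (unique-fv w)) (unique-fv (WF⇒WFs wN)) disj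

fv-eras : ∀ xs M → fv (eras xs M) ≡ xs ++ fv M
fv-eras [] M = refl
fv-eras (x ∷ xs) M = cong (x ∷_) (fv-eras xs M)

WFs-eras : ∀ xs M → Unique xs → Disjoint xs (fv M) → WFs M → WFs (eras xs M)
WFs-eras [] M _ _ w = w
WFs-eras (x ∷ xs) M (x∉xs ∷ u) disj w =
  wfs-era x (eras xs M) (WFs-eras xs M u (λ (p , q) → disj (there p , q)) w) x∉
  where
  x∉ : x ∉ fv (eras xs M)
  x∉ p rewrite fv-eras xs M with ∈-++⁻ xs p
  ... | inj₁ q = Unique[x∷xs]⇒x∉xs (x∉xs ∷ u) q
  ... | inj₂ q = disj (here refl , q)

∈-split : ∀ {v : Var} {y z} Y Z → v ∈ Y ++ Z → v ∈ (y ∷ Y) ++ (z ∷ Z)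
∈-split Y Z p with ∈-++⁻ Y p
... | inj₁ q = there (∈-++⁺ˡ q)
... | inj₂ q = there (∈-++⁺ʳ Y (there q))

∉-split : ∀ {v : Var} {y z} Y Z → v ≢ y → v ≢ z → v ∉ Y ++ Z → v ∉ (y ∷ Y) ++ (z ∷ Z)
∉-split Y Z v≢y v≢z v∉ (here refl) = v≢y refl
∉-split Y Z v≢y v≢z v∉ (there p) with ∈-++⁻ Y p
... | inj₁ q = v∉ (∈-++⁺ˡ q)
... | inj₂ (here refl) = v≢z refl
... | inj₂ (there q) = v∉ (∈-++⁺ʳ Y q)

fv-dups⁻ : ∀ X Y Z B {v} → length Y ≡ length X → length Z ≡ length X
         → v ∈ fv (dups X Y Z B) → (v ∈ X) ⊎ (v ∈ fv B × v ∉ Y ++ Z)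
fv-dups⁻ [] [] [] B _ _ p = inj₂ (p , λ ())
fv-dups⁻ (x ∷ X) (y ∷ Y) (z ∷ Z) B _ _ (here refl) = inj₁ (here refl)
fv-dups⁻ (x ∷ X) (y ∷ Y) (z ∷ Z) B |Y| |Z| (there p) with ∈-∖∖⁻ (fv (dups X Y Z B)) y z p
... | q , v≢y , v≢z with fv-dups⁻ X Y Z B (suc-injective |Y|) (suc-injective |Z|) q
... | inj₁ r = inj₁ (there r)
... | inj₂ (r , v∉) = inj₂ (r , ∉-split Y Z v≢y v≢z v∉)

fv-dups⁺ˡ : ∀ X Y Z B {v} → length Y ≡ length X → length Z ≡ length X
          → Disjoint X (Y ++ Z) → v ∈ X → v ∈ fv (dups X Y Z B)
fv-dups⁺ˡ (x ∷ X) (y ∷ Y) (z ∷ Z) B _ _ _ (here refl) = here refl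
fv-dups⁺ˡ (x ∷ X) (y ∷ Y) (z ∷ Z) B |Y| |Z| disj (there p) =
  there (∈-∖∖⁺ _ y z
    (fv-dups⁺ˡ X Y Z B (suc-injective |Y|) (suc-injective |Z|)
       (λ (a , b) → disj (there a , ∈-split Y Z b)) p)
    (λ { refl → disj (there p , here refl) })
    (λ { refl → disj (there p , ∈-++⁺ʳ (y ∷ Y) (here refl)) }))

fv-dups⁺ʳ : ∀ X Y Z B {v} → length Y ≡ length X → length Z ≡ length X
          → v ∈ fv B → v ∉ Y ++ Z → v ∈ fv (dups X Y Z B)
fv-dups⁺ʳ [] [] [] B _ _ p _ = p
fv-dups⁺ʳ (x ∷ X) (y ∷ Y) (z ∷ Z) B |Y| |Z| p v∉ =
  there (∈-∖∖⁺ _ y z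
    (fv-dups⁺ʳ X Y Z B (suc-injective |Y|) (suc-injective |Z|) p (λ q → v∉ (∈-split Y Z q)))
    (λ { refl → v∉ (here refl) })
    (λ { refl → v∉ (∈-++⁺ʳ (y ∷ Y) (here refl)) }))

WFs-dups : ∀ X Y Z B → length Y ≡ length X → length Z ≡ length X
         → Unique X → Unique (Y ++ Z) → Y ++ Z ⊆ fv B
         → Disjoint X (Y ++ Z) → Disjoint X (fv B) → WFs B → WFs (dups X Y Z B)
WFs-dups [] [] [] B _ _ _ _ _ _ _ w = w
WFs-dups (x ∷ X) (y ∷ Y) (z ∷ Z) B |Y| |Z| (x∉X ∷ uX) uYZ YZ⊆B disjYZ disjB w =
  wfs-dup x y z D
    (WFs-dups X Y Z B |Y|' |Z|' uX uYZ' (λ p → YZ⊆B (∈-split Y Z p))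
       (λ (a , b) → disjYZ (there a , ∈-split Y Z b)) (λ (a , b) → disjB (there a , b)) w)
    (fv-dups⁺ʳ X Y Z B |Y|' |Z|' (YZ⊆B (here refl)) y∉)
    (fv-dups⁺ʳ X Y Z B |Y|' |Z|' (YZ⊆B (∈-++⁺ʳ (y ∷ Y) (here refl))) z∉)
    (λ { refl → y∉zZ (here refl) })
    x∉
  where
  D : Term
  D = dups X Y Z B
  |Y|' : length Y ≡ length X
  |Y|' = suc-injective |Y|
  |Z|' : length Z ≡ length X
  |Z|' = suc-injective |Z|
  parts : Unique (y ∷ Y) × Unique (z ∷ Z) × Disjoint (y ∷ Y) (z ∷ Z)
  parts = unique-++⁻ (y ∷ Y) (z ∷ Z) uYZ
  y∉zZ : y ∉ z ∷ Z
  y∉zZ q = proj₂ (proj₂ parts) (here refl , q)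
  uYZ' : Unique (Y ++ Z)
  uYZ' with parts
  ... | _ ∷ uY , _ ∷ uZ , disj = unique-++ uY uZ (λ (a , b) → disj (there a , there b))
  y∉ : y ∉ Y ++ Z
  y∉ p with ∈-++⁻ Y p
  ... | inj₁ q = Unique[x∷xs]⇒x∉xs (proj₁ parts) q
  ... | inj₂ q = y∉zZ (there q)
  z∉ : z ∉ Y ++ Z
  z∉ p with ∈-++⁻ Y p
  ... | inj₁ q = proj₂ (proj₂ parts) (there q , here refl)
  ... | inj₂ q = Unique[x∷xs]⇒x∉xs (proj₁ (proj₂ parts)) q
  x∉ : x ∉ (fv D ∖ y) ∖ z
  x∉ p with fv-dups⁻ X Y Z B |Y|' |Z|' (proj₁ (∈-∖∖⁻ (fv D) y z p))
  ... | inj₁ q = Unique[x∷xs]⇒x∉xs (x∉X ∷ uX) q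
  ... | inj₂ (q , _) = disjB (here refl , q)

-- Fresh copies of a term

zipRen : List Var → List Var → Var → Var
zipRen X Y = lookupRen (zip X Y)

avoids-zipRen : ∀ {L} X Y → (∀ {y} → y ∈ Y → y ∉ L) → Avoids (zipRen X Y) L
avoids-zipRen [] Y fresh v = inj₁ refl
avoids-zipRen (a ∷ X) [] fresh v = inj₁ refl
avoids-zipRen (a ∷ X) (b ∷ Y) fresh v with ≡-or-≢ a v
... | inj₁ a≡v = inj₂ (subst (_∉ _) (sym (lookup-hit a b (zip X Y) v a≡v)) (fresh (here refl)))
... | inj₂ a≢v with avoids-zipRen X Y (λ p → fresh (there p)) v
...   | inj₁ fixed = inj₁ (trans (lookup-miss a b (zip X Y) v a≢v) fixed)
...   | inj₂ f∉L  = inj₂ (subst (_∉ _) (sym (lookup-miss a b (zip X Y) v a≢v)) f∉L)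

zipRen-∈ : ∀ X Y {v} → length X ≡ length Y → v ∈ X → zipRen X Y v ∈ Y
zipRen-∈ (a ∷ X) (b ∷ Y) {v} |X| p with ≡-or-≢ a v
... | inj₁ a≡v = subst (_∈ b ∷ Y) (sym (lookup-hit a b (zip X Y) v a≡v)) (here refl)
... | inj₂ a≢v = subst (_∈ b ∷ Y) (sym (lookup-miss a b (zip X Y) v a≢v))
                   (there (zipRen-∈ X Y (suc-injective |X|) (∈-tail p a≢v)))

zipRen-tail : ∀ a b X Y {w} → length X ≡ length Y → w ∈ a ∷ X → a ≢ w
            → zipRen (a ∷ X) (b ∷ Y) w ∈ Y
zipRen-tail a b X Y {w} |X| p a≢w =
  subst (_∈ Y) (sym (lookup-miss a b (zip X Y) w a≢w)) (zipRen-∈ X Y |X| (∈-tail p a≢w))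

zipRen-injectiveOn : ∀ X Y → length X ≡ length Y → Unique Y → InjectiveOn (zipRen X Y) X
zipRen-injectiveOn (a ∷ X) (b ∷ Y) |X| uY {v} {w} p q eq with ≡-or-≢ a v | ≡-or-≢ a w
... | inj₁ refl | inj₁ refl = refl
... | inj₁ refl | inj₂ a≢w =
  ⊥-elim (Unique[x∷xs]⇒x∉xs uY
    (subst (_∈ Y) (trans (sym eq) (lookup-hit a b (zip X Y) a refl))
      (zipRen-tail a b X Y (suc-injective |X|) q a≢w)))
... | inj₂ a≢v | inj₁ refl =
  ⊥-elim (Unique[x∷xs]⇒x∉xs uY
    (subst (_∈ Y) (trans eq (lookup-hit a b (zip X Y) a refl))
      (zipRen-tail a b X Y (suc-injective |X|) p a≢v)))
... | inj₂ a≢v | inj₂ a≢w with uY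
...   | _ ∷ uY' =
  zipRen-injectiveOn X Y (suc-injective |X|) uY' (∈-tail p a≢v) (∈-tail q a≢w)
    (trans (sym (lookup-miss a b (zip X Y) v a≢v)) (trans eq (lookup-miss a b (zip X Y) w a≢w)))

zipRen-onto : ∀ X Y {y} → length X ≡ length Y → Unique X → y ∈ Y → Image (zipRen X Y) X y
zipRen-onto (a ∷ X) (b ∷ Y) |X| uX (here refl) = a , here refl , lookup-hit a b (zip X Y) a refl
zipRen-onto (a ∷ X) (b ∷ Y) |X| uX@(_ ∷ uX') (there p)
  with zipRen-onto X Y (suc-injective |X|) uX' p
... | v , v∈X , eq =
  v , there v∈X , trans (lookup-miss a b (zip X Y) v (λ { refl → Unique[x∷xs]⇒x∉xs uX v∈X })) eq

fresh-copy : ∀ N ys → WF N → length (fv N) ≡ length ys → Unique ys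
           → (∀ {y} → y ∈ ys → y ∉ vars N)
           → WF (rename (zipRen (fv N) ys) N) × fv (rename (zipRen (fv N) ys) N) ≃ ys
fresh-copy N ys wN |fvN| uys fresh =
  WF-rename N f av (zipRen-injectiveOn (fv N) ys |fvN| uys) wN , copy⊆ys , ys⊆copy
  where
  f : Var → Var
  f = zipRen (fv N) ys
  av : Avoids f (vars N)
  av = avoids-zipRen (fv N) ys fresh
  copy⊆ys : fv (rename f N) ⊆ ys
  copy⊆ys p with fv-rename⁻ N f p
  ... | v , v∈N , refl = zipRen-∈ (fv N) ys |fvN| v∈N
  ys⊆copy : ys ⊆ fv (rename f N)
  ys⊆copy p with zipRen-onto (fv N) ys |fvN| (unique-fv (WF⇒WFs wN)) p
  ... | v , v∈N , refl = fv-rename⁺ N f av v∈N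

preserves-r-var : ∀ x N → Preserves (sub (var x) x N) N
preserves-r-var x N (wfs-sub _ _ _ _ _ wN _) = WF⇒WFs wN , to , ∈-++⁺ʳ ((x ∷ []) ∖ x)
  where
  to : ((x ∷ []) ∖ x) ++ fv N ⊆ fv N
  to p with ∈-++⁻ ((x ∷ []) ∖ x) p
  ... | inj₂ q = q
  ... | inj₁ q with ∈-∖⁻ (x ∷ []) x q
  ...   | here refl , v≢x = ⊥-elim (v≢x refl)

preserves-r-lam : ∀ y M x N → x ≢ y → y ∉ fv N → Preserves (sub (lam y M) x N) (lam y (sub M x N))
preserves-r-lam y M x N x≢y y∉N (wfs-sub _ _ _ (wfs-lam _ _ wM y∈M) x∈λ wN disj) =
  wfs-lam y (sub M x N) (wfs-sub M x N wM x∈M wN disj') y∈ , to , from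
  where
  x∈M : x ∈ fv M
  x∈M = proj₁ (∈-∖⁻ (fv M) y x∈λ)
  disj' : Disjoint (fv M ∖ x) (fv N)
  disj' (p , q) with ∈-∖⁻ (fv M) x p
  ... | p' , v≢x = disj (∈-∖∖⁺ (fv M) y x p' (λ { refl → y∉N q }) v≢x , q)
  y∈ : y ∈ (fv M ∖ x) ++ fv N
  y∈ = ∈-++⁺ˡ (∈-∖⁺ (fv M) x y∈M (≢-sym x≢y))
  to : ((fv M ∖ y) ∖ x) ++ fv N ⊆ ((fv M ∖ x) ++ fv N) ∖ y
  to p with ∈-++⁻ ((fv M ∖ y) ∖ x) p
  ... | inj₁ q = let r , v≢y , v≢x = ∈-∖∖⁻ (fv M) y x q in
                 ∈-∖⁺ _ y (∈-++⁺ˡ (∈-∖⁺ (fv M) x r v≢x)) v≢y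
  ... | inj₂ q = ∈-∖⁺ _ y (∈-++⁺ʳ (fv M ∖ x) q) (λ { refl → y∉N q })
  from : ((fv M ∖ x) ++ fv N) ∖ y ⊆ ((fv M ∖ y) ∖ x) ++ fv N
  from p with ∈-∖⁻ ((fv M ∖ x) ++ fv N) y p
  ... | p' , v≢y with ∈-++⁻ (fv M ∖ x) p'
  ...   | inj₁ q = let r , v≢x = ∈-∖⁻ (fv M) x q in ∈-++⁺ˡ (∈-∖∖⁺ (fv M) y x r v≢y v≢x)
  ...   | inj₂ q = ∈-++⁺ʳ ((fv M ∖ y) ∖ x) q

preserves-r-appl : ∀ M P x N → x ∈ fv M → Preserves (sub (app M P) x N) (app (sub M x N) P)
preserves-r-appl M P x N x∈M (wfs-sub _ _ _ (wfs-app _ _ wM wP disjMP) _ wN disj) =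
  wfs-app (sub M x N) P (wfs-sub M x N wM x∈M wN disjM) wP disj' , to , from
  where
  x∉P : ∀ {v} → v ∈ fv P → v ≢ x
  x∉P q refl = disjMP (x∈M , q)
  disjM : Disjoint (fv M ∖ x) (fv N)
  disjM (p , q) = disj (∖-mono {fv M} {fv M ++ fv P} x ∈-++⁺ˡ p , q)
  disj' : Disjoint ((fv M ∖ x) ++ fv N) (fv P)
  disj' (p , q) with ∈-++⁻ (fv M ∖ x) p
  ... | inj₁ r = disjMP (proj₁ (∈-∖⁻ (fv M) x r) , q)
  ... | inj₂ r = disj (∈-∖⁺ _ x (∈-++⁺ʳ (fv M) q) (x∉P q) , r)
  to : (fv M ++ fv P) ∖ x ++ fv N ⊆ ((fv M ∖ x) ++ fv N) ++ fv P
  to p with ∈-++⁻ ((fv M ++ fv P) ∖ x) p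
  ... | inj₂ q = ∈-++⁺ˡ (∈-++⁺ʳ (fv M ∖ x) q)
  ... | inj₁ q with ∈-∖⁻ (fv M ++ fv P) x q
  ...   | q' , v≢x with ∈-++⁻ (fv M) q'
  ...     | inj₁ r = ∈-++⁺ˡ (∈-++⁺ˡ (∈-∖⁺ (fv M) x r v≢x))
  ...     | inj₂ r = ∈-++⁺ʳ ((fv M ∖ x) ++ fv N) r
  from : ((fv M ∖ x) ++ fv N) ++ fv P ⊆ (fv M ++ fv P) ∖ x ++ fv N
  from p with ∈-++⁻ ((fv M ∖ x) ++ fv N) p
  ... | inj₂ q = ∈-++⁺ˡ (∈-∖⁺ _ x (∈-++⁺ʳ (fv M) q) (x∉P q))
  ... | inj₁ q with ∈-++⁻ (fv M ∖ x) q
  ...   | inj₁ r = ∈-++⁺ˡ (∖-mono {fv M} {fv M ++ fv P} x ∈-++⁺ˡ r)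
  ...   | inj₂ r = ∈-++⁺ʳ ((fv M ++ fv P) ∖ x) r

preserves-r-appr : ∀ M P x N → x ∈ fv P → Preserves (sub (app M P) x N) (app M (sub P x N))
preserves-r-appr M P x N x∈P (wfs-sub _ _ _ (wfs-app _ _ wM wP disjMP) _ wN disj) =
  wfs-app M (sub P x N) wM (wfs-sub P x N wP x∈P wN disjP) disj' , to , from
  where
  x∉M : ∀ {v} → v ∈ fv M → v ≢ x
  x∉M q refl = disjMP (q , x∈P)
  disjP : Disjoint (fv P ∖ x) (fv N)
  disjP (p , q) = disj (∖-mono x (∈-++⁺ʳ (fv M)) p , q)
  disj' : Disjoint (fv M) ((fv P ∖ x) ++ fv N)
  disj' (q , p) with ∈-++⁻ (fv P ∖ x) p
  ... | inj₁ r = disjMP (q , proj₁ (∈-∖⁻ (fv P) x r))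
  ... | inj₂ r = disj (∈-∖⁺ _ x (∈-++⁺ˡ q) (x∉M q) , r)
  to : (fv M ++ fv P) ∖ x ++ fv N ⊆ fv M ++ ((fv P ∖ x) ++ fv N)
  to p with ∈-++⁻ ((fv M ++ fv P) ∖ x) p
  ... | inj₂ q = ∈-++⁺ʳ (fv M) (∈-++⁺ʳ (fv P ∖ x) q)
  ... | inj₁ q with ∈-∖⁻ (fv M ++ fv P) x q
  ...   | q' , v≢x with ∈-++⁻ (fv M) q'
  ...     | inj₁ r = ∈-++⁺ˡ r
  ...     | inj₂ r = ∈-++⁺ʳ (fv M) (∈-++⁺ˡ (∈-∖⁺ (fv P) x r v≢x))
  from : fv M ++ ((fv P ∖ x) ++ fv N) ⊆ (fv M ++ fv P) ∖ x ++ fv N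
  from p with ∈-++⁻ (fv M) p
  ... | inj₁ q = ∈-++⁺ˡ (∈-∖⁺ _ x (∈-++⁺ˡ q) (x∉M q))
  ... | inj₂ q with ∈-++⁻ (fv P ∖ x) q
  ...   | inj₁ r = ∈-++⁺ˡ (∖-mono x (∈-++⁺ʳ (fv M)) r)
  ...   | inj₂ r = ∈-++⁺ʳ ((fv M ++ fv P) ∖ x) r

preserves-r-era : ∀ y M x N → x ≢ y → Preserves (sub (era y M) x N) (era y (sub M x N))
preserves-r-era y M x N x≢y (wfs-sub _ _ _ (wfs-era _ _ wM y∉M) x∈ wN disj) =
  wfs-era y (sub M x N) (wfs-sub M x N wM (∈-tail x∈ (≢-sym x≢y)) wN disj') y∉ , to , from
  where
  disj' : Disjoint (fv M ∖ x) (fv N)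
  disj' (p , q) = disj (∖-mono {fv M} {y ∷ fv M} x there p , q)
  y∉ : y ∉ (fv M ∖ x) ++ fv N
  y∉ p with ∈-++⁻ (fv M ∖ x) p
  ... | inj₁ q = y∉M (proj₁ (∈-∖⁻ (fv M) x q))
  ... | inj₂ q = disj (∈-∖⁺ (y ∷ fv M) x (here refl) (≢-sym x≢y) , q)
  to : (y ∷ fv M) ∖ x ++ fv N ⊆ y ∷ ((fv M ∖ x) ++ fv N)
  to p with ∈-++⁻ ((y ∷ fv M) ∖ x) p
  ... | inj₂ q = there (∈-++⁺ʳ (fv M ∖ x) q)
  ... | inj₁ q with ∈-∖⁻ (y ∷ fv M) x q
  ...   | here refl , _ = here refl
  ...   | there r , v≢x = there (∈-++⁺ˡ (∈-∖⁺ (fv M) x r v≢x))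
  from : y ∷ ((fv M ∖ x) ++ fv N) ⊆ (y ∷ fv M) ∖ x ++ fv N
  from (here refl) = ∈-++⁺ˡ (∈-∖⁺ (y ∷ fv M) x (here refl) (≢-sym x≢y))
  from (there p) with ∈-++⁻ (fv M ∖ x) p
  ... | inj₁ q = ∈-++⁺ˡ (∖-mono {fv M} {y ∷ fv M} x there q)
  ... | inj₂ q = ∈-++⁺ʳ ((y ∷ fv M) ∖ x) q

preserves-r-eraₓ : ∀ M x N → Preserves (sub (era x M) x N) (eras (fv N) M)
preserves-r-eraₓ M x N (wfs-sub _ _ _ (wfs-era _ _ wM x∉M) _ wN disj) =
  WFs-eras (fv N) M (unique-fv (WF⇒WFs wN)) disj' wM ,
  (λ p → subst (_ ∈_) (sym (fv-eras (fv N) M)) (to p)) ,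
  (λ p → from (subst (_ ∈_) (fv-eras (fv N) M) p))
  where
  x∉ : ∀ {v} → v ∈ fv M → v ≢ x
  x∉ q refl = x∉M q
  disj' : Disjoint (fv N) (fv M)
  disj' (q , p) = disj (∈-∖⁺ (x ∷ fv M) x (there p) (x∉ p) , q)
  to : (x ∷ fv M) ∖ x ++ fv N ⊆ fv N ++ fv M
  to p with ∈-++⁻ ((x ∷ fv M) ∖ x) p
  ... | inj₂ q = ∈-++⁺ˡ q
  ... | inj₁ q with ∈-∖⁻ (x ∷ fv M) x q
  ...   | here refl , v≢x = ⊥-elim (v≢x refl)
  ...   | there r , _ = ∈-++⁺ʳ (fv N) r
  from : fv N ++ fv M ⊆ (x ∷ fv M) ∖ x ++ fv N
  from p with ∈-++⁻ (fv N) p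
  ... | inj₁ q = ∈-++⁺ʳ ((x ∷ fv M) ∖ x) q
  ... | inj₂ q = ∈-++⁺ˡ (∈-∖⁺ (x ∷ fv M) x (there q) (x∉ q))

preserves-r-dup : ∀ y y₁ y₂ M x N → x ≢ y → x ≢ y₁ → x ≢ y₂ → y₁ ∉ fv N → y₂ ∉ fv N
                → Preserves (sub (dup y y₁ y₂ M) x N) (dup y y₁ y₂ (sub M x N))
preserves-r-dup y y₁ y₂ M x N x≢y x≢y₁ x≢y₂ y₁∉N y₂∉N
  (wfs-sub _ _ _ (wfs-dup _ _ _ _ wM y₁∈M y₂∈M y₁≢y₂ y∉) x∈ wN disj) =
  wfs-dup y y₁ y₂ (sub M x N) (wfs-sub M x N wM x∈M wN disj')
    (∈-++⁺ˡ (∈-∖⁺ (fv M) x y₁∈M (≢-sym x≢y₁))) (∈-++⁺ˡ (∈-∖⁺ (fv M) x y₂∈M (≢-sym x≢y₂)))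
    y₁≢y₂ y∉' ,
  to , from
  where
  body : List Var
  body = (fv M ∖ y₁) ∖ y₂
  N∉bound : ∀ {v} → v ∈ fv N → v ≢ y₁ × v ≢ y₂
  N∉bound q = (λ { refl → y₁∉N q }) , (λ { refl → y₂∉N q })
  x∈M : x ∈ fv M
  x∈M = proj₁ (∈-∖∖⁻ (fv M) y₁ y₂ (∈-tail x∈ (≢-sym x≢y)))
  disj' : Disjoint (fv M ∖ x) (fv N)
  disj' (p , q) with ∈-∖⁻ (fv M) x p | N∉bound q
  ... | p' , v≢x | v≢y₁ , v≢y₂ =
    disj (∈-∖⁺ (y ∷ body) x (there (∈-∖∖⁺ (fv M) y₁ y₂ p' v≢y₁ v≢y₂)) v≢x , q)
  y∉' : y ∉ (((fv M ∖ x) ++ fv N) ∖ y₁) ∖ y₂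
  y∉' p with ∈-∖∖⁻ ((fv M ∖ x) ++ fv N) y₁ y₂ p
  ... | q , y≢y₁ , y≢y₂ with ∈-++⁻ (fv M ∖ x) q
  ...   | inj₁ r = y∉ (∈-∖∖⁺ (fv M) y₁ y₂ (proj₁ (∈-∖⁻ (fv M) x r)) y≢y₁ y≢y₂)
  ...   | inj₂ r = disj (∈-∖⁺ (y ∷ body) x (here refl) (≢-sym x≢y) , r)
  to : (y ∷ body) ∖ x ++ fv N ⊆ y ∷ ((((fv M ∖ x) ++ fv N) ∖ y₁) ∖ y₂)
  to p with ∈-++⁻ ((y ∷ body) ∖ x) p
  ... | inj₂ q = let v≢y₁ , v≢y₂ = N∉bound q in
                 there (∈-∖∖⁺ _ y₁ y₂ (∈-++⁺ʳ (fv M ∖ x) q) v≢y₁ v≢y₂)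
  ... | inj₁ q with ∈-∖⁻ (y ∷ body) x q
  ...   | here refl , _ = here refl
  ...   | there r , v≢x =
    let r' , v≢y₁ , v≢y₂ = ∈-∖∖⁻ (fv M) y₁ y₂ r in
    there (∈-∖∖⁺ _ y₁ y₂ (∈-++⁺ˡ (∈-∖⁺ (fv M) x r' v≢x)) v≢y₁ v≢y₂)
  from : y ∷ ((((fv M ∖ x) ++ fv N) ∖ y₁) ∖ y₂) ⊆ (y ∷ body) ∖ x ++ fv N
  from (here refl) = ∈-++⁺ˡ (∈-∖⁺ (y ∷ body) x (here refl) (≢-sym x≢y))
  from (there p) with ∈-∖∖⁻ ((fv M ∖ x) ++ fv N) y₁ y₂ p
  ... | q , v≢y₁ , v≢y₂ with ∈-++⁻ (fv M ∖ x) q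
  ...   | inj₂ r = ∈-++⁺ʳ ((y ∷ body) ∖ x) r
  ...   | inj₁ r =
    let r' , v≢x = ∈-∖⁻ (fv M) x r in
    ∈-++⁺ˡ (∈-∖⁺ (y ∷ body) x (there (∈-∖∖⁺ (fv M) y₁ y₂ r' v≢y₁ v≢y₂)) v≢x)

module DuplicationRule
  (x₁ x₂ : Var) (M : Term) (x : Var) (N : Term) (ys zs : List Var)
  (|ys| : length ys ≡ length (fv N)) (|zs| : length zs ≡ length (fv N))
  (u : Unique (ys ++ zs))
  (fresh : ∀ v → v ∈ ys ++ zs → v ∉ vars (sub (dup x x₁ x₂ M) x N))
  (wM : WFs M) (x₁∈M : x₁ ∈ fv M) (x₂∈M : x₂ ∈ fv M) (x₁≢x₂ : x₁ ≢ x₂)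
  (x∉ : x ∉ (fv M ∖ x₁) ∖ x₂) (wN : WF N)
  (disj : Disjoint ((x ∷ ((fv M ∖ x₁) ∖ x₂)) ∖ x) (fv N))
  where

  X : List Var
  X = fv N

  N₁ N₂ B : Term
  N₁ = rename (zipRen X ys) N
  N₂ = rename (zipRen X zs) N
  B = sub (sub M x₁ N₁) x₂ N₂

  uys : Unique ys
  uys = proj₁ (unique-++⁻ ys zs u)

  uzs : Unique zs
  uzs = proj₁ (proj₂ (unique-++⁻ ys zs u))

  ys#zs : Disjoint ys zs
  ys#zs = proj₂ (proj₂ (unique-++⁻ ys zs u))

  fresh-M : ∀ {v} → v ∈ ys ++ zs → v ∉ fv M
  fresh-M p q = fresh _ p (there (∈-++⁺ˡ (there (there (there (fv⊆vars M q))))))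

  fresh-N : ∀ {v} → v ∈ ys ++ zs → v ∉ vars N
  fresh-N p q = fresh _ p (there (∈-++⁺ʳ (x ∷ x₁ ∷ x₂ ∷ vars M) q))

  fresh-x₂ : ∀ {v} → v ∈ ys ++ zs → v ≢ x₂
  fresh-x₂ p refl = fresh _ p (there (∈-++⁺ˡ {ys = vars N} (there (there (here refl)))))

  copy₁ : WF N₁ × fv N₁ ≃ ys
  copy₁ = fresh-copy N ys wN (sym |ys|) uys (λ p → fresh-N (∈-++⁺ˡ p))

  copy₂ : WF N₂ × fv N₂ ≃ zs
  copy₂ = fresh-copy N zs wN (sym |zs|) uzs (λ p → fresh-N (∈-++⁺ʳ ys p))

  X#ys++zs : Disjoint X (ys ++ zs)
  X#ys++zs (p , q) = fresh-N q (fv⊆vars N p)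

  wB : WFs B
  wB = wfs-sub (sub M x₁ N₁) x₂ N₂
         (wfs-sub M x₁ N₁ wM x₁∈M (proj₁ copy₁) disj₁)
         (∈-++⁺ˡ (∈-∖⁺ (fv M) x₁ x₂∈M (≢-sym x₁≢x₂))) (proj₁ copy₂) disj₂
    where
    disj₁ : Disjoint (fv M ∖ x₁) (fv N₁)
    disj₁ (p , q) = fresh-M (∈-++⁺ˡ (proj₁ (proj₂ copy₁) q)) (proj₁ (∈-∖⁻ (fv M) x₁ p))
    disj₂ : Disjoint (((fv M ∖ x₁) ++ fv N₁) ∖ x₂) (fv N₂)
    disj₂ (p , q) with ∈-++⁻ (fv M ∖ x₁) (proj₁ (∈-∖⁻ _ x₂ p))
    ... | inj₁ r = fresh-M (∈-++⁺ʳ ys (proj₁ (proj₂ copy₂) q)) (proj₁ (∈-∖⁻ (fv M) x₁ r))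
    ... | inj₂ r = ys#zs (proj₁ (proj₂ copy₁) r , proj₁ (proj₂ copy₂) q)

  fv-B⁻ : ∀ {v} → v ∈ fv B → (v ∈ (fv M ∖ x₁) ∖ x₂) ⊎ (v ∈ ys ++ zs)
  fv-B⁻ p with ∈-++⁻ (((fv M ∖ x₁) ++ fv N₁) ∖ x₂) p
  ... | inj₂ q = inj₂ (∈-++⁺ʳ ys (proj₁ (proj₂ copy₂) q))
  ... | inj₁ q with ∈-∖⁻ ((fv M ∖ x₁) ++ fv N₁) x₂ q
  ...   | q' , v≢x₂ with ∈-++⁻ (fv M ∖ x₁) q'
  ...     | inj₁ r = inj₁ (∈-∖⁺ _ x₂ r v≢x₂)
  ...     | inj₂ r = inj₂ (∈-++⁺ˡ (proj₁ (proj₂ copy₁) r))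

  fv-B⁺ˡ : (fv M ∖ x₁) ∖ x₂ ⊆ fv B
  fv-B⁺ˡ p = let q , v≢x₂ = ∈-∖⁻ (fv M ∖ x₁) x₂ p in
             ∈-++⁺ˡ (∈-∖⁺ _ x₂ (∈-++⁺ˡ q) v≢x₂)

  fv-B⁺ʳ : ys ++ zs ⊆ fv B
  fv-B⁺ʳ p with ∈-++⁻ ys p
  ... | inj₁ q =
    ∈-++⁺ˡ (∈-∖⁺ _ x₂ (∈-++⁺ʳ (fv M ∖ x₁) (proj₂ (proj₂ copy₁) q)) (fresh-x₂ p))
  ... | inj₂ q = ∈-++⁺ʳ (((fv M ∖ x₁) ++ fv N₁) ∖ x₂) (proj₂ (proj₂ copy₂) q)

  body≢x : ∀ {v} → v ∈ (fv M ∖ x₁) ∖ x₂ → v ≢ x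
  body≢x p refl = x∉ p

  X#B : Disjoint X (fv B)
  X#B (p , q) with fv-B⁻ q
  ... | inj₁ r = disj (∈-∖⁺ (x ∷ ((fv M ∖ x₁) ∖ x₂)) x (there r) (body≢x r) , p)
  ... | inj₂ r = X#ys++zs (p , r)

  reduct : Term
  reduct = dups X ys zs B

  wf-reduct : WFs reduct
  wf-reduct = WFs-dups X ys zs B |ys| |zs| (unique-fv (WF⇒WFs wN)) u fv-B⁺ʳ X#ys++zs X#B wB

  fv-reduct : (x ∷ ((fv M ∖ x₁) ∖ x₂)) ∖ x ++ X ≃ fv reduct
  fv-reduct = to , from
    where
    to : (x ∷ ((fv M ∖ x₁) ∖ x₂)) ∖ x ++ X ⊆ fv reduct
    to p with ∈-++⁻ ((x ∷ ((fv M ∖ x₁) ∖ x₂)) ∖ x) p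
    ... | inj₂ q = fv-dups⁺ˡ X ys zs B |ys| |zs| X#ys++zs q
    ... | inj₁ q with ∈-∖⁻ (x ∷ ((fv M ∖ x₁) ∖ x₂)) x q
    ...   | here refl , v≢x = ⊥-elim (v≢x refl)
    ...   | there r , _ = fv-dups⁺ʳ X ys zs B |ys| |zs| (fv-B⁺ˡ r)
                            (λ s → fresh-M s (proj₁ (∈-∖∖⁻ (fv M) x₁ x₂ r)))
    from : fv reduct ⊆ (x ∷ ((fv M ∖ x₁) ∖ x₂)) ∖ x ++ X
    from p with fv-dups⁻ X ys zs B |ys| |zs| p
    ... | inj₁ q = ∈-++⁺ʳ ((x ∷ ((fv M ∖ x₁) ∖ x₂)) ∖ x) q
    ... | inj₂ (q , v∉) with fv-B⁻ q
    ...   | inj₁ r = ∈-++⁺ˡ (∈-∖⁺ (x ∷ ((fv M ∖ x₁) ∖ x₂)) x (there r) (body≢x r))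
    ...   | inj₂ r = ⊥-elim (v∉ r)

preserves-r-dupₓ : ∀ x₁ x₂ M x N ys zs → length ys ≡ length (fv N) → length zs ≡ length (fv N)
                 → Unique (ys ++ zs) → (∀ v → v ∈ ys ++ zs → v ∉ vars (sub (dup x x₁ x₂ M) x N))
                 → Preserves (sub (dup x x₁ x₂ M) x N)
                     (dups (fv N) ys zs (sub (sub M x₁ (rename (zipRen (fv N) ys) N)) x₂
                                              (rename (zipRen (fv N) zs) N)))
preserves-r-dupₓ x₁ x₂ M x N ys zs |ys| |zs| u fresh
  (wfs-sub _ _ _ (wfs-dup _ _ _ _ wM x₁∈M x₂∈M x₁≢x₂ x∉) _ wN disj) = wf-reduct , fv-reduct
  where open DuplicationRule x₁ x₂ M x N ys zs |ys| |zs| u fresh wM x₁∈M x₂∈M x₁≢x₂ x∉ wN disj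

preserves-root : ∀ {M N} → M ⟶r N → Preserves M N
preserves-root (r-var x N) = preserves-r-var x N
preserves-root (r-lam y M x N x≢y y∉N) = preserves-r-lam y M x N x≢y y∉N
preserves-root (r-appl M P x N x∈M) = preserves-r-appl M P x N x∈M
preserves-root (r-appr M P x N x∈P) = preserves-r-appr M P x N x∈P
preserves-root (r-era y M x N x≢y) = preserves-r-era y M x N x≢y
preserves-root (r-eraₓ M x N) = preserves-r-eraₓ M x N
preserves-root (r-dup y y₁ y₂ M x N x≢y x≢y₁ x≢y₂ y₁∉N y₂∉N) =
  preserves-r-dup y y₁ y₂ M x N x≢y x≢y₁ x≢y₂ y₁∉N y₂∉N
preserves-root (r-dupₓ x₁ x₂ M x N ys zs |ys| |zs| u fresh)
  rewrite ren≡rename (zip (fv N) ys) N | ren≡rename (zip (fv N) zs) N =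
  preserves-r-dupₓ x₁ x₂ M x N ys zs |ys| |zs| u fresh

NoSub-irreducible : ∀ {M N} → NoSub M → ¬ (M ⟶c N)
NoSub-irreducible () (c-root (r-var _ _))
NoSub-irreducible () (c-root (r-lam _ _ _ _ _ _))
NoSub-irreducible () (c-root (r-appl _ _ _ _ _))
NoSub-irreducible () (c-root (r-appr _ _ _ _ _))
NoSub-irreducible () (c-root (r-era _ _ _ _ _))
NoSub-irreducible () (c-root (r-eraₓ _ _ _))
NoSub-irreducible () (c-root (r-dup _ _ _ _ _ _ _ _ _ _ _))
NoSub-irreducible () (c-root (r-dupₓ _ _ _ _ _ _ _ _ _ _ _))
NoSub-irreducible ns (c-lam s) = NoSub-irreducible ns s
NoSub-irreducible (ns , _) (c-appl s) = NoSub-irreducible ns s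
NoSub-irreducible (_ , ns) (c-appr s) = NoSub-irreducible ns s
NoSub-irreducible ns (c-era s) = NoSub-irreducible ns s
NoSub-irreducible ns (c-dup s) = NoSub-irreducible ns s

-- Contextual steps preserve; the term substituted in M[N/x] lies in Λ_® and
-- therefore never steps.
preserves-⟶c : ∀ {M N} → M ⟶c N → Preserves M N
preserves-⟶c (c-root r) = preserves-root r
preserves-⟶c (c-lam s) = preserves-lam (preserves-⟶c s)
preserves-⟶c (c-appl s) = preserves-appl (preserves-⟶c s)
preserves-⟶c (c-appr s) = preserves-appr (preserves-⟶c s)
preserves-⟶c (c-era s) = preserves-era (preserves-⟶c s)
preserves-⟶c (c-dup s) = preserves-dup (preserves-⟶c s)
preserves-⟶c (c-subl s) = preserves-subl (preserves-⟶c s)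
preserves-⟶c (c-subr s) = preserves-subr (λ wN → ⊥-elim (NoSub-irreducible (WF⇒NoSub wN) s))

preserves-⟶ : ∀ {M N} → M ⟶ N → WFs M → WFs N
preserves-⟶ (_ , _ , M≡αM' , s , N'≡αN) wM =
  proj₁ (preserves-trans (forth (agree-α M≡αM'))
           (preserves-trans (preserves-⟶c s) (forth (agree-α N'≡αN))) wM)

preserves-⟶* : ∀ {M N} → M ⟶* N → WFs M → WFs N
preserves-⟶* ε wM = wM
preserves-⟶* (s ◅ ss) wM = preserves-⟶* ss (preserves-⟶ s wM)

-- A name larger than every name in L.  Only the two facts below are used
-- about it, so it is opaque and never unfolded during type checking.
opaque
  fresh : List Var → Var
  fresh L = suc (max 0 L)

  ≥fresh⇒∉ : ∀ L {v} → fresh L ≤ v → v ∉ L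
  ≥fresh⇒∉ L fresh≤v v∈L = <⇒≢ (≤-<-trans (All.lookup (xs≤max 0 L) v∈L) fresh≤v) refl

fresh∉ : ∀ L → fresh L ∉ L
fresh∉ L = ≥fresh⇒∉ L ≤-refl

block : Var → ℕ → List Var
block b n = applyUpTo (b +_) n

∈-block : ∀ b n {v} → v ∈ block b n → b ≤ v × v < b + n
∈-block b n p with ∈-applyUpTo⁻ (b +_) p
... | i , i<n , refl = m≤m+n b i , +-monoʳ-< b i<n

unique-block : ∀ b n → Unique (block b n)
unique-block b n = applyUpTo⁺₁ (b +_) n (λ i<j _ → <⇒≢ (+-monoʳ-< b i<j))

unique-blocks : ∀ b n → Unique (block b n ++ block (b + n) n)
unique-blocks b n = unique-++ (unique-block b n) (unique-block (b + n) n) apart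
  where
  apart : Disjoint (block b n) (block (b + n) n)
  apart (p , q) = <⇒≢ (<-≤-trans (proj₂ (∈-block b n p)) (proj₁ (∈-block (b + n) n q))) refl

blocks-≥ : ∀ b n {v} → v ∈ block b n ++ block (b + n) n → b ≤ v
blocks-≥ b n p with ∈-++⁻ (block b n) p
... | inj₁ q = proj₁ (∈-block b n q)
... | inj₂ q = ≤-trans (m≤m+n b n) (proj₁ (∈-block (b + n) n q))

-- Progress

Steps : Term → Set
Steps M = Σ Term λ N → M ⟶ N

step-in : ∀ (C : Term → Term)
        → (∀ {A B} → A ≡α B → C A ≡α C B) → (∀ {A B} → A ⟶c B → C A ⟶c C B)
        → ∀ {A} → Steps A → Steps (C A)
step-in C α-C c-C (N , A' , N' , A≡A' , s , N'≡N) =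
  C N , C A' , C N' , α-C A≡A' , c-C s , α-C N'≡N

root-step : ∀ {M N} → M ⟶r N → Steps M
root-step {N = N} r = N , _ , N , α-refl , c-root r , α-refl

∈∧∉⇒≢ : ∀ {a b : Var} {L} → a ∈ L → b ∉ L → a ≢ b
∈∧∉⇒≢ a∈L b∉L refl = b∉L a∈L

∈-vars-subˡ : ∀ {v} T x N → v ∈ vars T → v ∈ vars (sub T x N)
∈-vars-subˡ T x N p = there (∈-++⁺ˡ p)

∈-vars-subʳ : ∀ {v} T x N → v ∈ vars N → v ∈ vars (sub T x N)
∈-vars-subʳ T x N p = there (∈-++⁺ʳ (vars T) p)

-- (λy.M)[N/x] steps once y is renamed apart from x and N.
step-lam : ∀ y M x N → Steps (sub (lam y M) x N)
step-lam y M x N =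
  lam y' (sub M' x N) , sub (lam y' M') x N , lam y' (sub M' x N) ,
  α-csubl (α-step (α-lam y y' M (λ q → y'∉ (∈-vars-subˡ (lam y M) x N (there q))))) ,
  c-root (r-lam y' M' x N (∈∧∉⇒≢ (here refl) y'∉)
                          (λ q → y'∉ (∈-vars-subʳ (lam y M) x N (fv⊆vars N q)))) ,
  α-refl
  where
  T : Term
  T = sub (lam y M) x N
  y' : Var
  y' = fresh (vars T)
  y'∉ : y' ∉ vars T
  y'∉ = fresh∉ (vars T)
  M' : Term
  M' = ren ((y , y') ∷ []) M

-- (y <^{y₁}_{y₂} M)[N/x] with x ≢ y steps once y₁ and y₂ are renamed apart.
step-dup : ∀ y y₁ y₂ M x N → x ≢ y → Steps (sub (dup y y₁ y₂ M) x N)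
step-dup y y₁ y₂ M x N x≢y =
  _ , _ , _ ,
  α-trans (α-csubl (α-step (α-dup₁ y y₁ y₁' y₂ M
             (λ q → y₁'∉ (∈-vars-subˡ D x N (there (there (there q)))))
             (≢-sym (∈∧∉⇒≢ (∈-vars-subˡ D x N (here refl)) y₁'∉))
             (≢-sym (∈∧∉⇒≢ (∈-vars-subˡ D x N (there (there (here refl)))) y₁'∉)))))
          (α-csubl (α-step (α-dup₂ y y₁' y₂ y₂' M₁
             (λ q → y₂'∉ (∈-vars-subˡ D₁ x N (there (there (there q)))))
             (≢-sym (∈∧∉⇒≢ (∈-vars-subˡ D₁ x N (here refl)) y₂'∉))
             (≢-sym (∈∧∉⇒≢ (∈-vars-subˡ D₁ x N (there (here refl))) y₂'∉))))) ,
  c-root (r-dup y y₁' y₂' M₂ x N x≢y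
           (∈∧∉⇒≢ (here refl) y₁'∉) (∈∧∉⇒≢ (here refl) y₂'∉)
           (λ q → y₁'∉ (∈-vars-subʳ D x N (fv⊆vars N q)))
           (λ q → y₂'∉ (∈-vars-subʳ D₁ x N (fv⊆vars N q)))) ,
  α-refl
  where
  D D₁ M₁ M₂ : Term
  y₁' y₂' : Var
  D = dup y y₁ y₂ M
  y₁' = fresh (vars (sub D x N))
  M₁ = ren ((y₁ , y₁') ∷ []) M
  D₁ = dup y y₁' y₂ M₁
  y₂' = fresh (vars (sub D₁ x N))
  M₂ = ren ((y₂ , y₂') ∷ []) M₁
  y₁'∉ : y₁' ∉ vars (sub D x N)
  y₁'∉ = fresh∉ (vars (sub D x N))
  y₂'∉ : y₂' ∉ vars (sub D₁ x N)
  y₂'∉ = fresh∉ (vars (sub D₁ x N))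

-- (x <^{x₁}_{x₂} M)[N/x] steps, with two blocks of names above all in the redex.
step-dupₓ : ∀ x₁ x₂ M x N → Steps (sub (dup x x₁ x₂ M) x N)
step-dupₓ x₁ x₂ M x N =
  root-step (r-dupₓ x₁ x₂ M x N (block b n) (block (b + n) n)
              (length-applyUpTo (b +_) n) (length-applyUpTo ((b + n) +_) n)
              (unique-blocks b n)
              (λ v p → ≥fresh⇒∉ (vars T) (blocks-≥ b n p)))
  where
  T : Term
  T = sub (dup x x₁ x₂ M) x N
  b n : ℕ
  b = fresh (vars T)
  n = length (fv N)

step-sub : ∀ M x N → NoSub M → x ∈ fv M → Steps (sub M x N)
step-sub (var y) x N _ (here refl) = root-step (r-var x N)
step-sub (lam y M) x N _ _ = step-lam y M x N
step-sub (app M P) x N _ x∈ with ∈-++⁻ (fv M) x∈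
... | inj₁ x∈M = root-step (r-appl M P x N x∈M)
... | inj₂ x∈P = root-step (r-appr M P x N x∈P)
step-sub (era y M) x N _ _ with ≡-or-≢ y x
... | inj₁ refl = root-step (r-eraₓ M y N)
... | inj₂ y≢x = root-step (r-era y M x N (≢-sym y≢x))
step-sub (dup y y₁ y₂ M) x N _ _ with ≡-or-≢ y x
... | inj₁ refl = step-dupₓ y₁ y₂ M y N
... | inj₂ y≢x = step-dup y y₁ y₂ M x N (≢-sym y≢x)
step-sub (sub M y P) x N () _

progress : ∀ M → WFs M → NoSub M ⊎ Steps M
progress (var x) _ = inj₁ tt
progress (lam x M) (wfs-lam _ _ wM _) with progress M wM
... | inj₁ ns = inj₁ ns
... | inj₂ s = inj₂ (step-in (lam x) α-cλ c-lam s)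
progress (app M N) (wfs-app _ _ wM wN _) with progress M wM | progress N wN
... | inj₂ s | _ = inj₂ (step-in (λ T → app T N) α-cappl c-appl s)
... | inj₁ _ | inj₂ s = inj₂ (step-in (app M) α-cappr c-appr s)
... | inj₁ ns | inj₁ ns' = inj₁ (ns , ns')
progress (era x M) (wfs-era _ _ wM _) with progress M wM
... | inj₁ ns = inj₁ ns
... | inj₂ s = inj₂ (step-in (era x) α-cera c-era s)
progress (dup x x₁ x₂ M) (wfs-dup _ _ _ _ wM _ _ _ _) with progress M wM
... | inj₁ ns = inj₁ ns
... | inj₂ s = inj₂ (step-in (dup x x₁ x₂) α-cdup c-dup s)
progress (sub M x N) (wfs-sub _ _ _ wM x∈M _ _) with progress M wM
... | inj₁ ns = inj₂ (step-sub M x N ns x∈M)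
... | inj₂ s = inj₂ (step-in (λ T → sub T x N) α-csubl c-subl s)

mainTheorem7 : ∀ M N → WFs M → M ⟶* N → Normal N → WF N
mainTheorem7 M N wM M⟶*N normal = conclude (progress N wN)
  where
  wN : WFs N
  wN = preserves-⟶* M⟶*N wM
  conclude : NoSub N ⊎ Steps N → WF N
  conclude (inj₁ noSub) = WFs∧NoSub⇒WF wN noSub
  conclude (inj₂ (N' , N⟶N')) = ⊥-elim (normal N' N⟶N')
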